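{- For integers $0\le k\le j\le n$, let $D(n,j,k)$ denote the number of partitions of $[n]=\{1,\dots,n\}$ into exactly $j$ blocks of which exactly $k$ blocks have size at least $2$ (and the remaining $j-k$ blocks are singletons). Then $$D(n,j,k)=\binom{n}{j-k}\sum_{0\le i \leq n-(j-k)} (-1)^{n-(j-k)-i}\binom{n-(j-k)}{i} S(i,j+i-n),$$ where $S(a,b)$ denotes the Stirling number of the second kind.
   Context: $S(a,b)$ is the number of partitions of an $a$-element set into $b$ nonempty blocks, with the conventions $S(0,0)=1$ and $S(a,b)=0$ if $b<0$ or $b>a$ or ($b=0<a$). A singleton block is a block of size $1$; a non-singleton block is a block of size at least $2$. -}

module Defs where

open import Data.Nat using (ℕ; zero; suc; _+_; _*_; _∸_; _≡ᵇ_; _≤ᵇ_; _<ᵇ_)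
open import Data.Bool using (Bool; true; false; _∧_; _∨_; not; if_then_else_)
open import Data.Fin using (Fin; toℕ)
open import Data.Vec using (Vec; []; _∷_; lookup; allFin)
open import Data.List as L using (List; []; _∷_)
open import Data.Integer as ℤ using (ℤ; +_; -[1+_])

-- Stirling numbers of the second kind, with the stated conventions:
-- S(0,0)=1, S(a,b)=0 if b<0 or b>a or b=0<a.  The second argument
-- ranges over ℤ so that S(a,b)=0 for b<0 is built in.

Sₙ : ℕ → ℕ → ℕ
Sₙ zero    zero    = 1
Sₙ zero    (suc b) = 0
Sₙ (suc a) zero    = 0
Sₙ (suc a) (suc b) = suc b * Sₙ a (suc b) + Sₙ a b

S : ℕ → ℤ → ℕ
S a (+ b)    = Sₙ a b
S a -[1+ b ] = 0

-- Set partitions of [n] = Fin n, represented (as usual) by the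
-- equivalence relation "lies in the same block".  A relation on Fin n
-- is an n×n Boolean matrix.

Relation : ℕ → Set
Relation n = Vec (Vec Bool n) n

rel : ∀ {n} → Relation n → Fin n → Fin n → Bool
rel R i l = lookup (lookup R i) l

allF : ∀ {n} → (Fin n → Bool) → Bool
allF {n} p = L.foldr (λ i b → p i ∧ b) true (L.allFin n)

countL : ∀ {A : Set} → (A → Bool) → List A → ℕ
countL p []       = 0
countL p (x ∷ xs) = (if p x then 1 else 0) + countL p xs

countF : ∀ {n} → (Fin n → Bool) → ℕ
countF {n} p = countL p (L.allFin n)

isEquivRel : ∀ {n} → Relation n → Bool
isEquivRel R =
  allF (λ i → rel R i i) ∧
  allF (λ i → allF (λ l → not (rel R i l) ∨ rel R l i)) ∧
  allF (λ i → allF (λ l → allF (λ m →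
        not (rel R i l ∧ rel R l m) ∨ rel R i m)))

-- i is the least element of its block (so blocks ↔ such i)
isBlockMin : ∀ {n} → Relation n → Fin n → Bool
isBlockMin R i = allF (λ l → not (toℕ l <ᵇ toℕ i) ∨ not (rel R l i))

blockSize : ∀ {n} → Relation n → Fin n → ℕ
blockSize R i = countF (λ l → rel R i l)

numBlocks : ∀ {n} → Relation n → ℕ
numBlocks R = countF (isBlockMin R)

numBigBlocks : ∀ {n} → Relation n → ℕ
numBigBlocks R = countF (λ i → isBlockMin R i ∧ (2 ≤ᵇ blockSize R i))

allVecs : ∀ {A : Set} → List A → (m : ℕ) → List (Vec A m)
allVecs xs zero    = [] ∷ []
allVecs xs (suc m) = L.concatMap (λ x → L.map (x ∷_) (allVecs xs m)) xs

allRelations : (n : ℕ) → List (Relation n)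
allRelations n = allVecs (allVecs (true ∷ false ∷ []) n) n

D : ℕ → ℕ → ℕ → ℕ
D n j k = countL (λ R → isEquivRel R ∧ (numBlocks R ≡ᵇ j)
                                   ∧ (numBigBlocks R ≡ᵇ k))
                 (allRelations n)

sumTo : ℕ → (ℕ → ℤ) → ℤ
sumTo zero    f = f 0
sumTo (suc m) f = sumTo m f ℤ.+ f (suc m)

module Submission where

-- Adding a point to a partition of [n] with s singletons and k blocks of size at least 2
-- makes it a new singleton, puts it into one of the k big blocks, or turns one of the s
-- singletons into a big block.  The resulting recurrence in (n, s, k) is also satisfied
-- by C(n,s) S≥2(n-s,k), where S≥2(m,k) counts partitions of an m-set into k blocks of
-- size at least 2 (choose the singletons, then partition the rest).  The alternating sum
-- of the theorem, with m = n - (j - k), satisfies the recurrence of S≥2(m,k), by Pascal's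
-- rule and the recurrence of S.

open import Defs

module FiniteSums where

  open import Data.Nat.Base
  open import Data.Nat.Properties
  open import Algebra.Properties.CommutativeSemigroup +-commutativeSemigroup using (interchange)
  open import Data.Bool.Base using (Bool; true; false; _∧_; not; if_then_else_)
  open import Data.Fin.Base using (Fin; zero; suc)
  import Data.Fin.Properties as Fin
  open import Data.List.Base as List using (List; []; _∷_; _++_; map; concatMap; allFin)
  open import Data.List.Properties using (map-tabulate)
  open import Data.Vec.Base using (Vec; []; _∷_; zipWith; lookup; tabulate)
  open import Data.Vec.Properties using (∷-injectiveˡ; ∷-injectiveʳ; tabulate∘lookup; tabulate-cong; ≡-dec)
  open import Data.Bool.Properties using (not-¬)
  import Data.Bool.Properties as Bool
  open import Relation.Binary.Definitions using (DecidableEquality)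
  open import Relation.Nullary.Decidable using (does; dec-true; dec-false)
  open import Function.Base using (id; _∘_)
  open import Relation.Binary.PropositionalEquality
  open import Relation.Nullary.Negation using (contradiction)
  open ≡-Reasoning

  private variable
    A B : Set
    m n : ℕ

  ∑ : List A → (A → ℕ) → ℕ
  ∑ []       f = 0
  ∑ (x ∷ xs) f = f x + ∑ xs f

  syntax ∑ xs (λ x → e) = ∑[ x ∈ xs ] e

  ∑-cong : ∀ xs {f g : A → ℕ} → (∀ x → f x ≡ g x) → ∑ xs f ≡ ∑ xs g
  ∑-cong []       f≗g = refl
  ∑-cong (x ∷ xs) f≗g = cong₂ _+_ (f≗g x) (∑-cong xs f≗g)

  ∑-zero : ∀ xs {f : A → ℕ} → (∀ x → f x ≡ 0) → ∑ xs f ≡ 0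
  ∑-zero []       f≗0 = refl
  ∑-zero (x ∷ xs) f≗0 = cong₂ _+_ (f≗0 x) (∑-zero xs f≗0)

  ∑-distrib-+ : ∀ xs (f g : A → ℕ) → ∑[ x ∈ xs ] (f x + g x) ≡ ∑ xs f + ∑ xs g
  ∑-distrib-+ []       f g = refl
  ∑-distrib-+ (x ∷ xs) f g =
    trans (cong (f x + g x +_) (∑-distrib-+ xs f g)) (interchange (f x) (g x) _ _)

  *-distribˡ-∑ : ∀ c xs (f : A → ℕ) → ∑[ x ∈ xs ] (c * f x) ≡ c * ∑ xs f
  *-distribˡ-∑ c []       f = sym (*-zeroʳ c)
  *-distribˡ-∑ c (x ∷ xs) f =
    trans (cong (c * f x +_) (*-distribˡ-∑ c xs f)) (sym (*-distribˡ-+ c (f x) _))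

  *-distribʳ-∑ : ∀ c xs (f : A → ℕ) → ∑[ x ∈ xs ] (f x * c) ≡ ∑ xs f * c
  *-distribʳ-∑ c xs f = begin
    ∑[ x ∈ xs ] (f x * c) ≡⟨ ∑-cong xs (λ x → *-comm (f x) c) ⟩
    ∑[ x ∈ xs ] (c * f x) ≡⟨ *-distribˡ-∑ c xs f ⟩
    c * ∑ xs f            ≡⟨ *-comm c _ ⟩
    ∑ xs f * c            ∎

  ∑-++ : ∀ xs ys (f : A → ℕ) → ∑ (xs ++ ys) f ≡ ∑ xs f + ∑ ys f
  ∑-++ []       ys f = refl
  ∑-++ (x ∷ xs) ys f = trans (cong (f x +_) (∑-++ xs ys f)) (sym (+-assoc (f x) _ _))

  ∑-map : ∀ (g : A → B) xs (f : B → ℕ) → ∑ (map g xs) f ≡ ∑[ x ∈ xs ] f (g x)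
  ∑-map g []       f = refl
  ∑-map g (x ∷ xs) f = cong (f (g x) +_) (∑-map g xs f)

  ∑-concatMap : ∀ (g : A → List B) xs (f : B → ℕ) →
                ∑ (concatMap g xs) f ≡ ∑[ x ∈ xs ] ∑ (g x) f
  ∑-concatMap g []       f = refl
  ∑-concatMap g (x ∷ xs) f =
    trans (∑-++ (g x) (concatMap g xs) f) (cong (∑ (g x) f +_) (∑-concatMap g xs f))

  ∑-comm : ∀ xs ys (f : A → B → ℕ) →
           ∑[ x ∈ xs ] ∑[ y ∈ ys ] f x y ≡ ∑[ y ∈ ys ] ∑[ x ∈ xs ] f x y
  ∑-comm []       ys f = sym (∑-zero ys (λ _ → refl))
  ∑-comm (x ∷ xs) ys f =
    trans (cong (∑ ys (f x) +_) (∑-comm xs ys f)) (sym (∑-distrib-+ ys (f x) _))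

  shift : (ℕ → ℕ) → ℕ → ℕ
  shift f zero    = 0
  shift f (suc x) = f x

  shift-cong : ∀ {f g : ℕ → ℕ} → (∀ t → f t ≡ g t) → ∀ x → shift f x ≡ shift g x
  shift-cong f≗g zero    = refl
  shift-cong f≗g (suc x) = f≗g x

  ind : Bool → ℕ
  ind b = if b then 1 else 0

  ind-∧ : ∀ a b → ind (a ∧ b) ≡ ind a * ind b
  ind-∧ true  b = sym (+-identityʳ (ind b))
  ind-∧ false b = refl

  countL≡∑ : ∀ (p : A → Bool) xs → countL p xs ≡ ∑[ x ∈ xs ] ind (p x)
  countL≡∑ p []       = refl
  countL≡∑ p (x ∷ xs) = cong (ind (p x) +_) (countL≡∑ p xs)

  ∑-allFin-suc : ∀ (f : Fin (suc n) → ℕ) → ∑ (allFin (suc n)) f ≡ f zero + ∑[ i ∈ allFin n ] f (suc i)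
  ∑-allFin-suc {n} f = cong (f zero +_) (begin
    ∑ (List.tabulate suc) f       ≡⟨ cong (λ xs → ∑ xs f) (map-tabulate id suc) ⟨
    ∑ (map suc (allFin n)) f      ≡⟨ ∑-map suc (allFin n) f ⟩
    ∑[ i ∈ allFin n ] f (suc i)   ∎)

  ∑-allFin-single : ∀ (f : Fin n → ℕ) i₀ → (∀ i → i ≢ i₀ → f i ≡ 0) → ∑ (allFin n) f ≡ f i₀
  ∑-allFin-single {suc n} f zero others = begin
    ∑ (allFin (suc n)) f                  ≡⟨ ∑-allFin-suc f ⟩
    f zero + ∑[ i ∈ allFin n ] f (suc i)  ≡⟨ cong (f zero +_) (∑-zero (allFin n) (λ i → others (suc i) λ ())) ⟩
    f zero + 0                            ≡⟨ +-identityʳ (f zero) ⟩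
    f zero                                ∎
  ∑-allFin-single {suc n} f (suc i₀) others = begin
    ∑ (allFin (suc n)) f                  ≡⟨ ∑-allFin-suc f ⟩
    f zero + ∑[ i ∈ allFin n ] f (suc i)  ≡⟨ cong₂ _+_ (others zero λ ()) (∑-allFin-single (f ∘ suc) i₀ others′) ⟩
    f (suc i₀)                            ∎
    where
    others′ : ∀ i → i ≢ i₀ → f (suc i) ≡ 0
    others′ i i≢i₀ = others (suc i) (i≢i₀ ∘ Fin.suc-injective)

  countF≡∑ : ∀ (p : Fin n → Bool) → countF p ≡ ∑[ i ∈ allFin n ] ind (p i)
  countF≡∑ {n} p = countL≡∑ p (allFin n)

  countF-suc : ∀ (p : Fin (suc n) → Bool) → countF p ≡ ind (p zero) + countF (p ∘ suc)
  countF-suc p = trans (countF≡∑ p) (trans (∑-allFin-suc (ind ∘ p)) (cong (ind (p zero) +_) (sym (countF≡∑ (p ∘ suc)))))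

  countF-cong : ∀ {p q : Fin n → Bool} → (∀ i → p i ≡ q i) → countF p ≡ countF q
  countF-cong {n} {p} {q} p≗q = begin
    countF p                    ≡⟨ countF≡∑ p ⟩
    ∑[ i ∈ allFin n ] ind (p i) ≡⟨ ∑-cong (allFin n) (cong ind ∘ p≗q) ⟩
    ∑[ i ∈ allFin n ] ind (q i) ≡⟨ countF≡∑ q ⟨
    countF q                    ∎

  countF-none : ∀ (p : Fin n → Bool) → (∀ i → p i ≡ false) → countF p ≡ 0
  countF-none {n} p none = trans (countF≡∑ p) (∑-zero (allFin n) (cong ind ∘ none))

  countF-split : ∀ (p q : Fin n → Bool) →
                 countF p ≡ countF (λ i → p i ∧ q i) + countF (λ i → p i ∧ not (q i))
  countF-split {n} p q = begin
    countF p                                                          ≡⟨ countF≡∑ p ⟩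
    ∑[ i ∈ allFin n ] ind (p i)                                        ≡⟨ ∑-cong (allFin n) (λ i → ind-split (p i) (q i)) ⟩
    ∑[ i ∈ allFin n ] (ind (p i ∧ q i) + ind (p i ∧ not (q i)))        ≡⟨ ∑-distrib-+ (allFin n) _ _ ⟩
    ∑[ i ∈ allFin n ] ind (p i ∧ q i) + ∑[ i ∈ allFin n ] ind (p i ∧ not (q i))
      ≡⟨ cong₂ _+_ (countF≡∑ (λ i → p i ∧ q i)) (countF≡∑ (λ i → p i ∧ not (q i))) ⟨
    countF (λ i → p i ∧ q i) + countF (λ i → p i ∧ not (q i))          ∎
    where
    ind-split : ∀ a b → ind a ≡ ind (a ∧ b) + ind (a ∧ not b)
    ind-split true  true  = refl
    ind-split true  false = refl
    ind-split false b     = refl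

  countF-atMost : ∀ (p : Fin n → Bool) i₀ → (∀ i → p i ≡ true → i ≡ i₀) → countF p ≡ ind (p i₀)
  countF-atMost {n} p i₀ only-i₀ = trans (countF≡∑ p) (∑-allFin-single (ind ∘ p) i₀ others)
    where
    others : ∀ i → i ≢ i₀ → ind (p i) ≡ 0
    others i i≢i₀ with p i in pᵢ
    ... | true  = contradiction (only-i₀ i pᵢ) i≢i₀
    ... | false = refl

  countF-≥1 : ∀ (p : Fin n → Bool) i → p i ≡ true → 1 ≤ countF p
  countF-≥1 {suc n} p zero    pᵢ rewrite countF-suc p | pᵢ = s≤s z≤n
  countF-≥1 {suc n} p (suc i) pᵢ rewrite countF-suc p = ≤-trans (countF-≥1 (p ∘ suc) i pᵢ) (m≤n+m _ _)

  ∑-allVecs-suc : ∀ xs (f : Vec A (suc m) → ℕ) →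
                  ∑ (allVecs xs (suc m)) f ≡ ∑[ x ∈ xs ] ∑[ v ∈ allVecs xs m ] f (x ∷ v)
  ∑-allVecs-suc {m = m} xs f = trans (∑-concatMap _ xs f) (∑-cong xs (λ x → ∑-map (x ∷_) (allVecs xs m) f))

  ∑-allVecs-column : ∀ xs (g : Vec (Vec A (suc n)) m → ℕ) →
                     ∑ (allVecs (allVecs xs (suc n)) m) g
                     ≡ ∑[ c ∈ allVecs xs m ] ∑[ M ∈ allVecs (allVecs xs n) m ] g (zipWith _∷_ c M)
  ∑-allVecs-column {m = zero}  xs g = sym (+-identityʳ _)
  ∑-allVecs-column {n = n} {m = suc m} xs g = begin
    ∑ (allVecs (allVecs xs (suc n)) (suc m)) g
      ≡⟨ ∑-allVecs-suc (allVecs xs (suc n)) g ⟩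
    ∑[ row ∈ allVecs xs (suc n) ] ∑[ M ∈ allVecs (allVecs xs (suc n)) m ] g (row ∷ M)
      ≡⟨ ∑-allVecs-suc xs _ ⟩
    ∑[ x ∈ xs ] ∑[ row ∈ allVecs xs n ] ∑[ M ∈ allVecs (allVecs xs (suc n)) m ] g ((x ∷ row) ∷ M)
      ≡⟨ ∑-cong xs (λ x → ∑-cong (allVecs xs n) (λ row → ∑-allVecs-column xs (λ M → g ((x ∷ row) ∷ M)))) ⟩
    ∑[ x ∈ xs ] ∑[ row ∈ allVecs xs n ] ∑[ c ∈ allVecs xs m ] ∑[ M ∈ allVecs (allVecs xs n) m ] g ((x ∷ row) ∷ zipWith _∷_ c M)
      ≡⟨ ∑-cong xs (λ x → ∑-comm (allVecs xs n) (allVecs xs m) _) ⟩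
    ∑[ x ∈ xs ] ∑[ c ∈ allVecs xs m ] ∑[ row ∈ allVecs xs n ] ∑[ M ∈ allVecs (allVecs xs n) m ] g ((x ∷ row) ∷ zipWith _∷_ c M)
      ≡⟨ ∑-cong xs (λ x → ∑-cong (allVecs xs m) (λ c → ∑-allVecs-suc (allVecs xs n) _)) ⟨
    ∑[ x ∈ xs ] ∑[ c ∈ allVecs xs m ] ∑[ M ∈ allVecs (allVecs xs n) (suc m) ] g (zipWith _∷_ (x ∷ c) M)
      ≡⟨ ∑-allVecs-suc xs _ ⟨
    ∑[ c ∈ allVecs xs (suc m) ] ∑[ M ∈ allVecs (allVecs xs n) (suc m) ] g (zipWith _∷_ c M)
      ∎

  bools : List Bool
  bools = true ∷ false ∷ []

  boolVecs : ∀ n → List (Vec Bool n)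
  boolVecs = allVecs bools

  ∑-bools-single : ∀ (h : Bool → ℕ) b → h (not b) ≡ 0 → ∑ bools h ≡ h b
  ∑-bools-single h true  h-false≡0 = trans (cong (h true +_) (cong (_+ 0) h-false≡0)) (+-identityʳ (h true))
  ∑-bools-single h false h-true≡0  = trans (cong (_+ (h false + 0)) h-true≡0) (+-identityʳ (h false))

  ∑-boolVecs-single : ∀ (f : Vec Bool n → ℕ) w → (∀ v → v ≢ w → f v ≡ 0) → ∑ (boolVecs n) f ≡ f w
  ∑-boolVecs-single {zero}  f []      others = +-identityʳ (f [])
  ∑-boolVecs-single {suc n} f (b ∷ w) others = begin
    ∑ (boolVecs (suc n)) f
      ≡⟨ ∑-allVecs-suc bools f ⟩
    ∑[ x ∈ bools ] ∑[ v ∈ boolVecs n ] f (x ∷ v)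
      ≡⟨ ∑-bools-single (λ x → ∑[ v ∈ boolVecs n ] f (x ∷ v)) b
           (∑-zero (boolVecs n) λ v → others (not b ∷ v) (not-¬ refl ∘ sym ∘ ∷-injectiveˡ)) ⟩
    ∑[ v ∈ boolVecs n ] f (b ∷ v)
      ≡⟨ ∑-boolVecs-single (f ∘ (b ∷_)) w (λ v v≢w → others (b ∷ v) (v≢w ∘ ∷-injectiveʳ)) ⟩
    f (b ∷ w)
      ∎

  _≟ᵥ_ : DecidableEquality (Vec Bool n)
  _≟ᵥ_ = ≡-dec Bool._≟_

  lookup-injective : ∀ {v w : Vec Bool n} → (∀ i → lookup v i ≡ lookup w i) → v ≡ w
  lookup-injective {v = v} {w} v≗w = trans (sym (tabulate∘lookup v)) (trans (tabulate-cong v≗w) (tabulate∘lookup w))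

  ∑-boolVecs-δ : ∀ w (f : Vec Bool n → ℕ) → ∑[ v ∈ boolVecs n ] (ind (does (v ≟ᵥ w)) * f v) ≡ f w
  ∑-boolVecs-δ w f = trans
    (∑-boolVecs-single (λ v → ind (does (v ≟ᵥ w)) * f v) w λ v v≢w → cong (λ b → ind b * f v) (dec-false (v ≟ᵥ w) v≢w))
    (trans (cong (λ b → ind b * f w) (dec-true (w ≟ᵥ w) refl)) (*-identityˡ (f w)))

  ∑-boolVecs-count : ∀ (p : Fin n → Bool) (ws : Fin n → Vec Bool n) (f : Vec Bool n → ℕ) →
    ∑[ v ∈ boolVecs n ] (countF (λ i → p i ∧ does (v ≟ᵥ ws i)) * f v) ≡ ∑[ i ∈ allFin n ] (ind (p i) * f (ws i))
  ∑-boolVecs-count {n} p ws f = begin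
    ∑[ v ∈ boolVecs n ] (countF (λ i → p i ∧ does (v ≟ᵥ ws i)) * f v)
      ≡⟨ ∑-cong (boolVecs n) (λ v → trans (cong (_* f v) (countF≡∑ (λ i → p i ∧ does (v ≟ᵥ ws i))))
                                            (sym (*-distribʳ-∑ (f v) (allFin n) λ i → ind (p i ∧ does (v ≟ᵥ ws i))))) ⟩
    ∑[ v ∈ boolVecs n ] ∑[ i ∈ allFin n ] (ind (p i ∧ does (v ≟ᵥ ws i)) * f v)
      ≡⟨ ∑-comm (boolVecs n) (allFin n) (λ v i → ind (p i ∧ does (v ≟ᵥ ws i)) * f v) ⟩
    ∑[ i ∈ allFin n ] ∑[ v ∈ boolVecs n ] (ind (p i ∧ does (v ≟ᵥ ws i)) * f v)
      ≡⟨ ∑-cong (allFin n) (λ i → ∑-cong (boolVecs n) λ v →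
           trans (cong (_* f v) (ind-∧ (p i) _)) (*-assoc (ind (p i)) _ (f v))) ⟩
    ∑[ i ∈ allFin n ] ∑[ v ∈ boolVecs n ] (ind (p i) * (ind (does (v ≟ᵥ ws i)) * f v))
      ≡⟨ ∑-cong (allFin n) (λ i → trans (*-distribˡ-∑ (ind (p i)) (boolVecs n) (λ v → ind (does (v ≟ᵥ ws i)) * f v))
                                        (cong (ind (p i) *_) (∑-boolVecs-δ (ws i) f))) ⟩
    ∑[ i ∈ allFin n ] (ind (p i) * f (ws i))
      ∎

  ∑-allRelations-suc : ∀ (f : Relation (suc n) → ℕ) →
    ∑ (allRelations (suc n)) f
    ≡ ∑[ R ∈ allRelations n ] ∑[ a ∈ bools ] ∑[ row ∈ boolVecs n ] ∑[ col ∈ boolVecs n ]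
        f ((a ∷ row) ∷ zipWith _∷_ col R)
  ∑-allRelations-suc {n} f = begin
    ∑ (allRelations (suc n)) f
      ≡⟨ ∑-allVecs-suc (boolVecs (suc n)) f ⟩
    ∑[ row₀ ∈ boolVecs (suc n) ] ∑[ M ∈ allVecs (boolVecs (suc n)) n ] f (row₀ ∷ M)
      ≡⟨ ∑-allVecs-suc bools (λ row₀ → ∑[ M ∈ allVecs (boolVecs (suc n)) n ] f (row₀ ∷ M)) ⟩
    ∑[ a ∈ bools ] ∑[ row ∈ boolVecs n ] ∑[ M ∈ allVecs (boolVecs (suc n)) n ] f ((a ∷ row) ∷ M)
      ≡⟨ ∑-cong bools (λ a → ∑-cong (boolVecs n) (λ row → ∑-allVecs-column bools (λ M → f ((a ∷ row) ∷ M)))) ⟩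
    ∑[ a ∈ bools ] ∑[ row ∈ boolVecs n ] ∑[ col ∈ boolVecs n ] ∑[ R ∈ allRelations n ] g a row col R
      ≡⟨ ∑-cong bools (λ a → ∑-cong (boolVecs n) (λ row → ∑-comm (boolVecs n) (allRelations n) (g a row))) ⟩
    ∑[ a ∈ bools ] ∑[ row ∈ boolVecs n ] ∑[ R ∈ allRelations n ] ∑[ col ∈ boolVecs n ] g a row col R
      ≡⟨ ∑-cong bools (λ a → ∑-comm (boolVecs n) (allRelations n) (λ row R → ∑[ col ∈ boolVecs n ] g a row col R)) ⟩
    ∑[ a ∈ bools ] ∑[ R ∈ allRelations n ] ∑[ row ∈ boolVecs n ] ∑[ col ∈ boolVecs n ] g a row col R
      ≡⟨ ∑-comm bools (allRelations n) (λ a R → ∑[ row ∈ boolVecs n ] ∑[ col ∈ boolVecs n ] g a row col R) ⟩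
    ∑[ R ∈ allRelations n ] ∑[ a ∈ bools ] ∑[ row ∈ boolVecs n ] ∑[ col ∈ boolVecs n ] g a row col R
      ∎
    where
    g : Bool → Vec Bool n → Vec Bool n → Relation n → ℕ
    g a row col R = f ((a ∷ row) ∷ zipWith _∷_ col R)

module BooleanRelations where

  open FiniteSums
  open import Data.Nat.Base
  open import Data.Nat.Properties using (<⇒<ᵇ; <ᵇ⇒<; <-cmp)
  open import Relation.Binary.Definitions using (tri<; tri≈; tri>)
  open import Data.Bool.Base using (Bool; true; false; _∧_; _∨_; not)
  open import Data.Bool.Properties using (∧-conicalˡ; ∧-conicalʳ; ¬-not; not-¬; not-injective; ⇔→≡; T-≡)
  open import Data.Empty using (⊥-elim)
  import Data.Bool.Properties as Bool
  open import Data.Fin.Base using (Fin; zero; suc; toℕ; fromℕ<)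
  open import Data.Fin.Properties using (toℕ-injective; toℕ-inject; toℕ-fromℕ<; ¬∀⟶∃¬-smallest)
  open import Data.List.Base as List using (List; foldr; map; allFin)
  open import Data.List.Properties using (foldr-cong; foldr-map; map-tabulate)
  open import Data.Product.Base using (∃-syntax; _×_; _,_)
  open import Function.Base using (id; _∘_)
  open import Function.Bundles using (mk⇔; Equivalence)
  open import Relation.Binary.Structures using (IsEquivalence)
  open import Relation.Binary.PropositionalEquality using (_≡_; refl; sym; trans; cong; cong₂; subst; module ≡-Reasoning)
  open import Relation.Nullary.Negation using (¬_; contradiction)

  private variable
    n : ℕ

  BoolRel : ℕ → Set
  BoolRel n = Fin n → Fin n → Bool

  Related : BoolRel n → Fin n → Fin n → Set
  Related r i l = r i l ≡ true

  _≐_ : BoolRel n → BoolRel n → Set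
  r ≐ r′ = ∀ i l → r i l ≡ r′ i l

  allF-suc : ∀ (p : Fin (suc n) → Bool) → allF p ≡ p zero ∧ allF (p ∘ suc)
  allF-suc {n} p = cong (p zero ∧_) (begin
    foldr (λ i b → p i ∧ b) true (List.tabulate suc)     ≡⟨ cong (foldr (λ i b → p i ∧ b) true) (map-tabulate id suc) ⟨
    foldr (λ i b → p i ∧ b) true (map suc (allFin n))    ≡⟨ foldr-map _ suc true (allFin n) ⟩
    allF (p ∘ suc)                                        ∎)
    where open ≡-Reasoning

  allF⁺ : ∀ (p : Fin n → Bool) → (∀ i → p i ≡ true) → allF p ≡ true
  allF⁺ {zero}  p all = refl
  allF⁺ {suc n} p all rewrite allF-suc p | all zero = allF⁺ (p ∘ suc) (all ∘ suc)

  allF⁻ : ∀ (p : Fin n → Bool) → allF p ≡ true → ∀ i → p i ≡ true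
  allF⁻ {suc n} p holds i rewrite allF-suc p with i
  ... | zero  = ∧-conicalˡ _ _ holds
  ... | suc i = allF⁻ (p ∘ suc) (∧-conicalʳ _ _ holds) i

  allF-cong : ∀ {p q : Fin n → Bool} → (∀ i → p i ≡ q i) → allF p ≡ allF q
  allF-cong {n} p≗q = foldr-cong (λ i b → cong (_∧ b) (p≗q i)) refl (allFin n)

  -- For R : Relation n, isEquivRel R, numBlocks R and numBigBlocks R are by definition
  -- isEquivalence, countF ∘ isLeast and bigBlocks at rel R; relations given as functions
  -- can be extended by a point without rebuilding a matrix.
  reflexiveᵇ symmetricᵇ transitiveᵇ isEquivalence : BoolRel n → Bool
  reflexiveᵇ r    = allF (λ i → r i i)
  symmetricᵇ r    = allF (λ i → allF (λ l → not (r i l) ∨ r l i))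
  transitiveᵇ r   = allF (λ i → allF (λ l → allF (λ m → not (r i l ∧ r l m) ∨ r i m)))
  isEquivalence r = reflexiveᵇ r ∧ symmetricᵇ r ∧ transitiveᵇ r

  isLeast : BoolRel n → Fin n → Bool
  isLeast r i = allF (λ l → not (toℕ l <ᵇ toℕ i) ∨ not (r l i))

  size : BoolRel n → Fin n → ℕ
  size r i = countF (r i)

  big small : ℕ → Bool
  big s   = 2 ≤ᵇ s
  small s = not (big s)

  big-suc : ∀ {m} → 1 ≤ m → big (suc m) ≡ true
  big-suc (s≤s z≤n) = refl

  blocksWith : (ℕ → Bool) → BoolRel n → ℕ
  blocksWith q r = countF (λ i → isLeast r i ∧ q (size r i))

  singletons bigBlocks : BoolRel n → ℕ
  singletons = blocksWith small
  bigBlocks  = blocksWith big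

  private
    ⇒-intro : ∀ {a b} → (a ≡ true → b ≡ true) → not a ∨ b ≡ true
    ⇒-intro {true}  a⇒b = a⇒b refl
    ⇒-intro {false} a⇒b = refl

    ⇒-elim : ∀ {a b} → not a ∨ b ≡ true → a ≡ true → b ≡ true
    ⇒-elim a⇒b refl = a⇒b

    ∧-intro : ∀ {a b} → a ≡ true → b ≡ true → a ∧ b ≡ true
    ∧-intro refl refl = refl

  isEquivalence⁻ : ∀ (r : BoolRel n) → isEquivalence r ≡ true → IsEquivalence (Related r)
  isEquivalence⁻ r holds = record
    { refl  = λ {i} → allF⁻ _ reflexive i
    ; sym   = λ {i} {l} → ⇒-elim (allF⁻ (λ l → not (r i l) ∨ r l i) (allF⁻ _ symmetric i) l)
    ; trans = λ {i} {l} {m} p q →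
        ⇒-elim (allF⁻ (λ m → not (r i l ∧ r l m) ∨ r i m) (allF⁻ _ (allF⁻ _ transitive i) l) m) (∧-intro p q)
    }
    where
    reflexive : reflexiveᵇ r ≡ true
    reflexive = ∧-conicalˡ (reflexiveᵇ r) _ holds
    symmetric : symmetricᵇ r ≡ true
    symmetric = ∧-conicalˡ (symmetricᵇ r) _ (∧-conicalʳ (reflexiveᵇ r) _ holds)
    transitive : transitiveᵇ r ≡ true
    transitive = ∧-conicalʳ (symmetricᵇ r) _ (∧-conicalʳ (reflexiveᵇ r) _ holds)

  isEquivalence⁺ : ∀ (r : BoolRel n) → IsEquivalence (Related r) → isEquivalence r ≡ true
  isEquivalence⁺ r eq = ∧-intro reflexive (∧-intro symmetric transitive)
    where
    module E = IsEquivalence eq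
    reflexive : reflexiveᵇ r ≡ true
    reflexive = allF⁺ _ λ i → E.refl {i}
    symmetric : symmetricᵇ r ≡ true
    symmetric = allF⁺ _ λ i → allF⁺ _ λ l → ⇒-intro (E.sym {i} {l})
    transitive : transitiveᵇ r ≡ true
    transitive = allF⁺ _ λ i → allF⁺ _ λ l → allF⁺ _ λ m → ⇒-intro λ p →
      E.trans {i} {l} {m} (∧-conicalˡ _ _ p) (∧-conicalʳ _ _ p)

  isEquivalence-false : ∀ (r : BoolRel n) → ¬ IsEquivalence (Related r) → isEquivalence r ≡ false
  isEquivalence-false r ¬eq with isEquivalence r in holds
  ... | true  = contradiction (isEquivalence⁻ r holds) ¬eq
  ... | false = refl

  isEquivalence-cong : ∀ {r r′ : BoolRel n} → r ≐ r′ → isEquivalence r ≡ isEquivalence r′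
  isEquivalence-cong r≐r′ = cong₂ _∧_
    (allF-cong λ i → r≐r′ i i)
    (cong₂ _∧_ (allF-cong λ i → allF-cong λ l → cong₂ (λ a b → not a ∨ b) (r≐r′ i l) (r≐r′ l i))
               (allF-cong λ i → allF-cong λ l → allF-cong λ m →
                  cong₂ (λ a b → not a ∨ b) (cong₂ _∧_ (r≐r′ i l) (r≐r′ l m)) (r≐r′ i m)))

  isLeast-cong : ∀ {r r′ : BoolRel n} → r ≐ r′ → ∀ i → isLeast r i ≡ isLeast r′ i
  isLeast-cong r≐r′ i = allF-cong λ l → cong (λ b → not (toℕ l <ᵇ toℕ i) ∨ not b) (r≐r′ l i)

  blocksWith-cong : ∀ q {r r′ : BoolRel n} → r ≐ r′ → blocksWith q r ≡ blocksWith q r′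
  blocksWith-cong q r≐r′ = countF-cong λ i →
    cong₂ (λ a s → a ∧ q s) (isLeast-cong r≐r′ i) (countF-cong (r≐r′ i))

  isLeast⁻ : ∀ (r : BoolRel n) {i l} → isLeast r i ≡ true → toℕ l < toℕ i → r l i ≡ false
  isLeast⁻ r {i} {l} least l<i =
    not-injective (⇒-elim (allF⁻ _ least l) (Equivalence.to T-≡ (<⇒<ᵇ l<i)))

  isLeast⁺ : ∀ (r : BoolRel n) {i} → (∀ l → toℕ l < toℕ i → r l i ≡ false) → isLeast r i ≡ true
  isLeast⁺ r below = allF⁺ _ λ l → ⇒-intro λ l<ᵇi →
    cong not (below l (<ᵇ⇒< _ _ (Equivalence.from T-≡ l<ᵇi)))

  module _ {r : BoolRel n} (eq : IsEquivalence (Related r)) where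
    private module E = IsEquivalence eq

    least-of-block : ∀ l → ∃[ i ] (Related r i l × isLeast r i ≡ true)
    least-of-block l with ¬∀⟶∃¬-smallest n (λ i → r i l ≡ false) (λ i → r i l Bool.≟ false)
                         (λ none → not-¬ E.refl (none l))
    ... | i , i∼l , before-i = i , ¬-not i∼l , isLeast⁺ r below
      where
      below : ∀ l′ → toℕ l′ < toℕ i → r l′ i ≡ false
      below l′ l′<i with r l′ i in l′∼i
      ... | false = refl
      ... | true  = ⊥-elim (not-¬ (E.trans l′∼i (¬-not i∼l)) l′≁l)
        where
        j : Fin (toℕ i)
        j = fromℕ< l′<i
        l′≁l : r l′ l ≡ false
        l′≁l = subst (λ x → r x l ≡ false) (toℕ-injective (trans (toℕ-inject j) (toℕ-fromℕ< l′<i))) (before-i j)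

    least-unique : ∀ {i j} → isLeast r i ≡ true → isLeast r j ≡ true → Related r i j → i ≡ j
    least-unique {i} {j} least-i least-j i∼j with <-cmp (toℕ i) (toℕ j)
    ... | tri< i<j _ _ = ⊥-elim (not-¬ i∼j (isLeast⁻ r least-j i<j))
    ... | tri≈ _ i≡j _ = toℕ-injective i≡j
    ... | tri> _ _ j<i = ⊥-elim (not-¬ (E.sym i∼j) (isLeast⁻ r least-i j<i))

    related⇒same-row : ∀ {i l} → Related r i l → ∀ m → r l m ≡ r i m
    related⇒same-row i∼l m = ⇔→≡ (mk⇔ (E.trans i∼l) (E.trans (E.sym i∼l)))

module OnePointExtension where

  open FiniteSums
  open BooleanRelations
  open import Data.Nat.Base
  open import Data.Nat.Properties using (+-commutativeSemigroup)
  open import Algebra.Properties.CommutativeSemigroup +-commutativeSemigroup using (xy∙z≈x∙zy)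
  open import Data.Bool.Base using (Bool; true; false; _∧_; _∨_; not)
  open import Data.Bool.Properties using (¬-not; ⇔→≡; ∧-comm; ∧-identityʳ; ∧-conicalˡ; ∧-conicalʳ)
  import Data.Bool.Properties as Bool
  open import Data.Fin.Base using (Fin; zero; suc; toℕ)
  open import Data.Fin.Properties using (any?)
  open import Data.Product.Base using (∃-syntax; _×_; _,_)
  open import Data.Sum.Base using (_⊎_; inj₁; inj₂)
  open import Function.Bundles using (mk⇔)
  open import Relation.Binary.Structures using (IsEquivalence)
  open import Relation.Binary.PropositionalEquality using (_≡_; refl; sym; trans; cong; cong₂; module ≡-Reasoning)
  open import Relation.Nullary.Decidable using (yes; no)

  private variable
    n : ℕ

  ext : Bool → (Fin n → Bool) → (Fin n → Bool) → BoolRel n → BoolRel (suc n)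
  ext a row col r zero    zero    = a
  ext a row col r zero    (suc l) = row l
  ext a row col r (suc i) zero    = col i
  ext a row col r (suc i) (suc l) = r i l

  extend : (Fin n → Bool) → BoolRel n → BoolRel (suc n)
  extend v = ext true v v

  module _ {a row col} {r : BoolRel n} (eq : IsEquivalence (Related (ext a row col r))) where
    private module E = IsEquivalence eq

    ext-reflexive : a ≡ true
    ext-reflexive = E.refl {zero}

    ext-symmetric : ∀ i → col i ≡ row i
    ext-symmetric i = ⇔→≡ (mk⇔ (E.sym {suc i} {zero}) (E.sym {zero} {suc i}))

    ext-restrict : IsEquivalence (Related r)
    ext-restrict = record
      { refl  = λ {i} → E.refl {suc i}
      ; sym   = λ {i} {l} → E.sym {suc i} {suc l}
      ; trans = λ {i} {l} {m} → E.trans {suc i} {suc l} {suc m}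
      }

  module _ {r : BoolRel n} (eq : IsEquivalence (Related r)) where
    private module E = IsEquivalence eq

    extend-empty-isEquivalence : IsEquivalence (Related (extend (λ _ → false) r))
    extend-empty-isEquivalence = record
      { refl = λ {i} → reflexive i ; sym = λ {i} {l} → symmetric i l ; trans = λ {i} {l} {m} → transitive i l m }
      where
      R : BoolRel (suc n)
      R = extend (λ _ → false) r
      reflexive : ∀ i → Related R i i
      reflexive zero    = refl
      reflexive (suc i) = E.refl
      symmetric : ∀ i l → Related R i l → Related R l i
      symmetric zero    zero    p  = p
      symmetric zero    (suc l) ()
      symmetric (suc i) zero    ()
      symmetric (suc i) (suc l) p  = E.sym p
      transitive : ∀ i l m → Related R i l → Related R l m → Related R i m
      transitive zero    zero    m       p  q  = q
      transitive zero    (suc l) m       () q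
      transitive (suc i) zero    m       () q
      transitive (suc i) (suc l) zero    p  ()
      transitive (suc i) (suc l) (suc m) p  q  = E.trans p q

    extend-row-isEquivalence : ∀ i₀ → IsEquivalence (Related (extend (r i₀) r))
    extend-row-isEquivalence i₀ = record
      { refl = λ {i} → reflexive i ; sym = λ {i} {l} → symmetric i l ; trans = λ {i} {l} {m} → transitive i l m }
      where
      R : BoolRel (suc n)
      R = extend (r i₀) r
      reflexive : ∀ i → Related R i i
      reflexive zero    = refl
      reflexive (suc i) = E.refl
      symmetric : ∀ i l → Related R i l → Related R l i
      symmetric zero    zero    p = p
      symmetric zero    (suc l) p = p
      symmetric (suc i) zero    p = p
      symmetric (suc i) (suc l) p = E.sym p
      transitive : ∀ i l m → Related R i l → Related R l m → Related R i m
      transitive zero    zero    m       p q = q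
      transitive zero    (suc l) zero    p q = refl
      transitive zero    (suc l) (suc m) p q = E.trans p q
      transitive (suc i) zero    zero    p q = p
      transitive (suc i) zero    (suc m) p q = E.trans (E.sym p) q
      transitive (suc i) (suc l) zero    p q = E.trans q (E.sym p)
      transitive (suc i) (suc l) (suc m) p q = E.trans p q

    extend-shape : ∀ {v} → IsEquivalence (Related (extend v r)) →
                   (∀ l → v l ≡ false) ⊎ ∃[ i ] (isLeast r i ≡ true × ∀ m → v m ≡ r i m)
    extend-shape {v} eq⁺ with any? (λ l → v l Bool.≟ true)
    ... | no  none        = inj₁ λ l → ¬-not λ vₗ → none (l , vₗ)
    ... | yes (l , vₗ) with least-of-block eq l
    ...   | i , i∼l , least = inj₂ (i , least , λ m →
              trans (related⇒same-row eq⁺ {suc l} {zero} vₗ (suc m)) (related⇒same-row eq i∼l m))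

  module _ (v : Fin n → Bool) (r : BoolRel n) where

    isLeast-extend-zero : isLeast (extend v r) zero ≡ true
    isLeast-extend-zero = allF⁺ (λ l → not (toℕ l <ᵇ 0) ∨ not (extend v r l zero)) λ l → refl

    isLeast-extend-suc : ∀ i → isLeast (extend v r) (suc i) ≡ not (v i) ∧ isLeast r i
    isLeast-extend-suc i = allF-suc (λ l → not (toℕ l <ᵇ toℕ (suc i)) ∨ not (extend v r l (suc i)))

    size-extend-zero : size (extend v r) zero ≡ suc (countF v)
    size-extend-zero = countF-suc (extend v r zero)

    size-extend-suc : ∀ i → size (extend v r) (suc i) ≡ ind (v i) + size r i
    size-extend-suc i = countF-suc (extend v r (suc i))

    blocksWith-extend : ∀ q → blocksWith q (extend v r)
                            ≡ ind (q (suc (countF v))) + countF (λ i → not (v i) ∧ (isLeast r i ∧ q (size r i)))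
    blocksWith-extend q = trans (countF-suc (λ i → isLeast (extend v r) i ∧ q (size (extend v r) i))) (cong₂ _+_
      (cong₂ (λ a s → ind (a ∧ q s)) isLeast-extend-zero size-extend-zero)
      (countF-cong λ i → trans (cong₂ (λ a s → a ∧ q s) (isLeast-extend-suc i) (size-extend-suc i))
                               (outside-block (v i))))
      where
      outside-block : ∀ b {a s} → (not b ∧ a) ∧ q (ind b + s) ≡ not b ∧ (a ∧ q s)
      outside-block true  = refl
      outside-block false = refl

  blocksWith-extend-empty : ∀ q (r : BoolRel n) → blocksWith q (extend (λ _ → false) r) ≡ ind (q 1) + blocksWith q r
  blocksWith-extend-empty {n} q r =
    trans (blocksWith-extend _ r q) (cong (λ c → ind (q (suc c)) + blocksWith q r) (countF-none {n} (λ _ → false) λ _ → refl))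

  -- Stated additively because the block of i₀ is replaced by one that is one larger.
  blocksWith-extend-row : ∀ q {r : BoolRel n} → IsEquivalence (Related r) → ∀ {i₀} → isLeast r i₀ ≡ true →
    blocksWith q (extend (r i₀) r) + ind (q (size r i₀)) ≡ ind (q (suc (size r i₀))) + blocksWith q r
  blocksWith-extend-row q {r} eq {i₀} least = begin
    blocksWith q (extend (r i₀) r) + old
      ≡⟨ cong (_+ old) (blocksWith-extend (r i₀) r q) ⟩
    new + countF (λ i → not (r i₀ i) ∧ P i) + old
      ≡⟨ cong (λ c → new + c + old) (countF-cong λ i → ∧-comm (not (r i₀ i)) (P i)) ⟩
    new + countF (λ i → P i ∧ not (r i₀ i)) + old
      ≡⟨ xy∙z≈x∙zy new _ old ⟩
    new + (old + countF (λ i → P i ∧ not (r i₀ i)))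
      ≡⟨ cong (λ c → new + (c + countF (λ i → P i ∧ not (r i₀ i)))) block-of-i₀ ⟨
    new + (countF (λ i → P i ∧ r i₀ i) + countF (λ i → P i ∧ not (r i₀ i)))
      ≡⟨ cong (new +_) (countF-split P (r i₀)) ⟨
    new + blocksWith q r
      ∎
    where
    open ≡-Reasoning
    new old : ℕ
    new = ind (q (suc (size r i₀)))
    old = ind (q (size r i₀))
    P : Fin _ → Bool
    P i = isLeast r i ∧ q (size r i)
    block-of-i₀ : countF (λ i → P i ∧ r i₀ i) ≡ ind (q (size r i₀))
    block-of-i₀ = trans
      (countF-atMost _ i₀ λ i Pᵢ → least-unique eq (∧-conicalˡ _ _ (∧-conicalˡ _ _ Pᵢ)) least
                                      (IsEquivalence.sym eq (∧-conicalʳ _ _ Pᵢ)))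
      (cong ind (trans (cong₂ (λ a b → (a ∧ q (size r i₀)) ∧ b) least (IsEquivalence.refl eq)) (∧-identityʳ _)))

module WeightedCounts where

  open FiniteSums
  open BooleanRelations
  open OnePointExtension
  open import Data.Nat.Base
  open import Data.Nat.Properties using (*-identityˡ; *-zeroʳ; *-distribʳ-+; +-identityʳ; +-comm; +-assoc; suc-injective)
  open import Data.Bool.Base using (Bool; true; false; _∧_; not; if_then_else_)
  open import Data.Bool.Properties using (∧-zeroʳ; ∧-conicalˡ; ∧-conicalʳ; not-¬)
  open import Data.Fin.Base using (Fin; zero; suc)
  open import Data.List.Base using (allFin)
  open import Data.Product.Base using (_,_)
  open import Data.Sum.Base using (inj₁; inj₂)
  open import Data.Vec.Base using (Vec; _∷_; lookup; replicate; tabulate; zipWith)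
  open import Data.Vec.Properties using (lookup-replicate; lookup∘tabulate; lookup-zipWith)
  open import Function.Base using (_∘_)
  open import Relation.Binary.Structures using (IsEquivalence)
  open import Relation.Binary.PropositionalEquality using (_≡_; _≢_; refl; sym; trans; cong; cong₂; module ≡-Reasoning)
  open import Relation.Nullary.Decidable using (does; yes; no; dec-true; dec-false)
  open import Relation.Nullary.Negation using (¬_; contradiction)

  private variable
    n : ℕ

  weight : (ℕ → ℕ → ℕ) → BoolRel n → ℕ
  weight φ r = ind (isEquivalence r) * φ (singletons r) (bigBlocks r)

  -- The new point is a singleton, joins one of the k big blocks, or joins one of the
  -- s singletons; in the last term the junk value pred 0 is multiplied by s = 0.
  step : (ℕ → ℕ → ℕ) → ℕ → ℕ → ℕ
  step φ s k = φ (suc s) k + k * φ s k + s * φ (pred s) (suc k)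

  weight-cong : ∀ φ {r r′ : BoolRel n} → r ≐ r′ → weight φ r ≡ weight φ r′
  weight-cong φ r≐r′ = cong₂ (λ e x → ind e * x) (isEquivalence-cong r≐r′)
    (cong₂ φ (blocksWith-cong small r≐r′) (blocksWith-cong big r≐r′))

  weight-nonEquivalence : ∀ φ (r : BoolRel n) → ¬ IsEquivalence (Related r) → weight φ r ≡ 0
  weight-nonEquivalence φ r ¬eq = cong (λ e → ind e * φ (singletons r) (bigBlocks r)) (isEquivalence-false r ¬eq)

  weight-equivalence : ∀ φ {r : BoolRel n} → IsEquivalence (Related r) → weight φ r ≡ φ (singletons r) (bigBlocks r)
  weight-equivalence φ {r} eq =
    trans (cong (λ e → ind e * φ (singletons r) (bigBlocks r)) (isEquivalence⁺ r eq)) (*-identityˡ _)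

  extend-cong : ∀ {v v′ : Fin n → Bool} → (∀ i → v i ≡ v′ i) → ∀ r → extend v r ≐ extend v′ r
  extend-cong v≗v′ r zero    zero    = refl
  extend-cong v≗v′ r zero    (suc l) = v≗v′ l
  extend-cong v≗v′ r (suc i) zero    = v≗v′ i
  extend-cong v≗v′ r (suc i) (suc l) = refl

  module _ (φ : ℕ → ℕ → ℕ) {r : BoolRel n} (eq : IsEquivalence (Related r)) where
    private
      s k : ℕ
      s = singletons r
      k = bigBlocks r

    weight-extend-empty : weight φ (extend (λ _ → false) r) ≡ φ (suc s) k
    weight-extend-empty = trans (weight-equivalence φ (extend-empty-isEquivalence eq))
      (cong₂ φ (blocksWith-extend-empty small r) (blocksWith-extend-empty big r))

    weight-extend-row : ∀ {i} → isLeast r i ≡ true →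
      weight φ (extend (r i) r) ≡ (if big (size r i) then φ s k else φ (pred s) (suc k))
    weight-extend-row {i} least = trans (weight-equivalence φ (extend-row-isEquivalence eq i))
      (shape (big (size r i))
        (trans (blocksWith-extend-row small eq least) (cong (λ b → ind (not b) + s) grows-big))
        (trans (blocksWith-extend-row big eq least) (cong (λ b → ind b + k) grows-big)))
      where
      grows-big : big (suc (size r i)) ≡ true
      grows-big = big-suc (countF-≥1 (r i) i (IsEquivalence.refl eq))
      shape : ∀ b {s′ k′} → s′ + ind (not b) ≡ s → k′ + ind b ≡ suc k →
              φ s′ k′ ≡ (if b then φ s k else φ (pred s) (suc k))
      shape true  s′+0≡s k′+1≡k+1 =
        cong₂ φ (trans (sym (+-identityʳ _)) s′+0≡s) (suc-injective (trans (+-comm 1 _) k′+1≡k+1))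
      shape false s′+1≡s k′+0≡k+1 =
        cong₂ φ (cong pred (trans (+-comm 1 _) s′+1≡s)) (trans (sym (+-identityʳ _)) k′+0≡k+1)

    least-weight-extend-row : ∀ i →
      ind (isLeast r i) * weight φ (extend (r i) r)
      ≡ ind (isLeast r i ∧ small (size r i)) * φ (pred s) (suc k) + ind (isLeast r i ∧ big (size r i)) * φ s k
    least-weight-extend-row i with isLeast r i in least
    ... | false = refl
    ... | true  = trans (*-identityˡ _) (trans (weight-extend-row least) (by-size (big (size r i))))
      where
      by-size : ∀ b → (if b then φ s k else φ (pred s) (suc k)) ≡ ind (not b) * φ (pred s) (suc k) + ind b * φ s k
      by-size true  = sym (+-identityʳ _)
      by-size false = trans (sym (+-identityʳ _)) (sym (+-identityʳ _))

  emptyVec : Vec Bool n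
  emptyVec = replicate _ false

  rowVec : BoolRel n → Fin n → Vec Bool n
  rowVec r i = tabulate (r i)

  module _ {r : BoolRel n} (eq : IsEquivalence (Related r)) where
    private module E = IsEquivalence eq

    extend-shape-unique : ∀ v → IsEquivalence (Related (extend (lookup v) r)) →
      ind (does (v ≟ᵥ emptyVec)) + countF (λ i → isLeast r i ∧ does (v ≟ᵥ rowVec r i)) ≡ 1
    extend-shape-unique v eq⁺ with extend-shape eq eq⁺
    ... | inj₁ none = cong₂ _+_
      (cong ind (dec-true (v ≟ᵥ emptyVec) (lookup-injective λ l → trans (none l) (sym (lookup-replicate l false)))))
      (countF-none _ λ i → trans (cong (isLeast r i ∧_) (dec-false (v ≟ᵥ rowVec r i) (v≢row i))) (∧-zeroʳ _))
      where
      v≢row : ∀ i → v ≢ rowVec r i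
      v≢row i v≡row = not-¬ (trans (cong (λ w → lookup w i) v≡row) (trans (lookup∘tabulate (r i) i) E.refl)) (none i)
    ... | inj₂ (i₀ , least₀ , v≗row) = cong₂ _+_
      (cong ind (dec-false (v ≟ᵥ emptyVec) λ v≡empty →
        not-¬ (trans (v≗row i₀) E.refl) (trans (cong (λ w → lookup w i₀) v≡empty) (lookup-replicate i₀ false))))
      (trans (countF-atMost _ i₀ only-i₀) (cong ind (cong₂ _∧_ least₀ (dec-true (v ≟ᵥ rowVec r i₀) v≡row₀))))
      where
      v≡row₀ : v ≡ rowVec r i₀
      v≡row₀ = lookup-injective λ m → trans (v≗row m) (sym (lookup∘tabulate (r i₀) m))
      only-i₀ : ∀ i → isLeast r i ∧ does (v ≟ᵥ rowVec r i) ≡ true → i ≡ i₀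
      only-i₀ i selected with v ≟ᵥ rowVec r i
      ... | no  _     = contradiction (∧-conicalʳ (isLeast r i) false selected) λ ()
      ... | yes v≡row = least-unique eq (∧-conicalˡ (isLeast r i) true selected) least₀ i∼i₀
        where
        i∼i₀ : Related r i i₀
        i∼i₀ = trans (sym (lookup∘tabulate (r i) i₀)) (trans (cong (λ w → lookup w i₀) (sym v≡row)) (trans (v≗row i₀) E.refl))

  module _ (φ : ℕ → ℕ → ℕ) {r : BoolRel n} (eq : IsEquivalence (Related r)) where
    private
      s k : ℕ
      s = singletons r
      k = bigBlocks r
      w isEmpty isBlockRow : Vec Bool n → ℕ
      w v          = weight φ (extend (lookup v) r)
      isEmpty v    = ind (does (v ≟ᵥ emptyVec))
      isBlockRow v = countF (λ i → isLeast r i ∧ does (v ≟ᵥ rowVec r i))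

    weight-extend-by-shape : ∀ v → w v ≡ (isEmpty v + isBlockRow v) * w v
    weight-extend-by-shape v = by-equivalence (isEquivalence R) refl
      where
      R : BoolRel (suc n)
      R = extend (lookup v) r
      by-equivalence : ∀ b → isEquivalence R ≡ b → w v ≡ (isEmpty v + isBlockRow v) * w v
      by-equivalence true  holds =
        sym (trans (cong (_* w v) (extend-shape-unique eq v (isEquivalence⁻ R holds))) (*-identityˡ (w v)))
      by-equivalence false holds =
        trans w≡0 (sym (trans (cong ((isEmpty v + isBlockRow v) *_) w≡0) (*-zeroʳ (isEmpty v + isBlockRow v))))
        where
        w≡0 : w v ≡ 0
        w≡0 = cong (λ b → ind b * φ (singletons R) (bigBlocks R)) holds

    ∑-weight-extend-isEquivalence : ∑[ v ∈ boolVecs n ] w v ≡ step φ s k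
    ∑-weight-extend-isEquivalence = begin
      ∑[ v ∈ boolVecs n ] w v
        ≡⟨ ∑-cong (boolVecs n) (λ v → trans (weight-extend-by-shape v) (*-distribʳ-+ (w v) (isEmpty v) _)) ⟩
      ∑[ v ∈ boolVecs n ] (isEmpty v * w v + isBlockRow v * w v)
        ≡⟨ ∑-distrib-+ (boolVecs n) _ _ ⟩
      ∑[ v ∈ boolVecs n ] (isEmpty v * w v) + ∑[ v ∈ boolVecs n ] (isBlockRow v * w v)
        ≡⟨ cong₂ _+_ (∑-boolVecs-δ emptyVec w) (∑-boolVecs-count (isLeast r) (rowVec r) w) ⟩
      w emptyVec + ∑[ i ∈ allFin n ] (ind (isLeast r i) * w (rowVec r i))
        ≡⟨ cong₂ _+_ w-empty (∑-cong (allFin n) λ i → cong (ind (isLeast r i) *_) (w-row i)) ⟩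
      φ (suc s) k + ∑[ i ∈ allFin n ] (ind (isLeast r i) * weight φ (extend (r i) r))
        ≡⟨ cong (φ (suc s) k +_) (trans (∑-cong (allFin n) (least-weight-extend-row φ eq)) (∑-distrib-+ (allFin n) _ _)) ⟩
      φ (suc s) k + (∑[ i ∈ allFin n ] (ind (isLeast r i ∧ small (size r i)) * φ (pred s) (suc k))
                     + ∑[ i ∈ allFin n ] (ind (isLeast r i ∧ big (size r i)) * φ s k))
        ≡⟨ cong (φ (suc s) k +_) (cong₂ _+_ (counted small) (counted big)) ⟩
      φ (suc s) k + (s * φ (pred s) (suc k) + k * φ s k)
        ≡⟨ cong (φ (suc s) k +_) (+-comm _ (k * φ s k)) ⟩
      φ (suc s) k + (k * φ s k + s * φ (pred s) (suc k))
        ≡⟨ +-assoc (φ (suc s) k) _ _ ⟨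
      step φ s k
        ∎
      where
      open ≡-Reasoning
      w-empty : w emptyVec ≡ φ (suc s) k
      w-empty = trans (weight-cong φ (extend-cong (λ l → lookup-replicate l false) r)) (weight-extend-empty φ eq)
      w-row : ∀ i → w (rowVec r i) ≡ weight φ (extend (r i) r)
      w-row i = weight-cong φ (extend-cong (lookup∘tabulate (r i)) r)
      counted : ∀ q {x} → ∑[ i ∈ allFin n ] (ind (isLeast r i ∧ q (size r i)) * x) ≡ blocksWith q r * x
      counted q {x} = trans (*-distribʳ-∑ x (allFin n) _) (cong (_* x) (sym (countF≡∑ (λ i → isLeast r i ∧ q (size r i)))))

  ∑-weight-ext : ∀ φ (r : BoolRel n) →
    ∑[ a ∈ bools ] ∑[ row ∈ boolVecs n ] ∑[ col ∈ boolVecs n ] weight φ (ext a (lookup row) (lookup col) r)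
    ≡ ∑[ v ∈ boolVecs n ] weight φ (extend (lookup v) r)
  ∑-weight-ext {n} φ r = trans
    (∑-bools-single (λ a → ∑[ row ∈ boolVecs n ] ∑[ col ∈ boolVecs n ] weight φ (ext a (lookup row) (lookup col) r)) true
       (∑-zero (boolVecs n) λ row → ∑-zero (boolVecs n) λ col →
          weight-nonEquivalence φ (ext false (lookup row) (lookup col) r) λ eq → contradiction (ext-reflexive eq) λ ()))
    (∑-cong (boolVecs n) λ row → ∑-boolVecs-single (λ col → weight φ (ext true (lookup row) (lookup col) r)) row λ col col≢row →
       weight-nonEquivalence φ (ext true (lookup row) (lookup col) r) λ eq → col≢row (lookup-injective (ext-symmetric eq)))

  ∑-weight-extend : ∀ φ (r : BoolRel n) → ∑[ v ∈ boolVecs n ] weight φ (extend (lookup v) r) ≡ weight (step φ) r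
  ∑-weight-extend {n} φ r = by-equivalence (isEquivalence r) refl
    where
    by-equivalence : ∀ b → isEquivalence r ≡ b → ∑[ v ∈ boolVecs n ] weight φ (extend (lookup v) r) ≡ weight (step φ) r
    by-equivalence true  holds = let eq = isEquivalence⁻ r holds in
      trans (∑-weight-extend-isEquivalence φ eq) (sym (weight-equivalence (step φ) eq))
    by-equivalence false holds = trans
      (∑-zero (boolVecs n) λ v → weight-nonEquivalence φ (extend (lookup v) r) λ eq⁺ →
         not-¬ (isEquivalence⁺ r (ext-restrict eq⁺)) holds)
      (sym (cong (λ b → ind b * step φ (singletons r) (bigBlocks r)) holds))

  rel-cons : ∀ a (row col : Vec Bool n) R → rel ((a ∷ row) ∷ zipWith _∷_ col R) ≐ ext a (lookup row) (lookup col) (rel R)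
  rel-cons a row col R zero    zero    = refl
  rel-cons a row col R zero    (suc l) = refl
  rel-cons a row col R (suc i) zero    = cong (λ xs → lookup xs zero) (lookup-zipWith _∷_ i col R)
  rel-cons a row col R (suc i) (suc l) = cong (λ xs → lookup xs (suc l)) (lookup-zipWith _∷_ i col R)

  ∑-weight-suc : ∀ φ → ∑[ R ∈ allRelations (suc n) ] weight φ (rel R) ≡ ∑[ R ∈ allRelations n ] weight (step φ) (rel R)
  ∑-weight-suc {n} φ = trans (∑-allRelations-suc {n} (weight φ ∘ rel)) (∑-cong (allRelations n) λ R → begin
    ∑[ a ∈ bools ] ∑[ row ∈ boolVecs n ] ∑[ col ∈ boolVecs n ] weight φ (rel ((a ∷ row) ∷ zipWith _∷_ col R))
      ≡⟨ ∑-cong bools (λ a → ∑-cong (boolVecs n) λ row → ∑-cong (boolVecs n) λ col → weight-cong φ (rel-cons a row col R)) ⟩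
    ∑[ a ∈ bools ] ∑[ row ∈ boolVecs n ] ∑[ col ∈ boolVecs n ] weight φ (ext a (lookup row) (lookup col) (rel R))
      ≡⟨ ∑-weight-ext φ (rel R) ⟩
    ∑[ v ∈ boolVecs n ] weight φ (extend (lookup v) (rel R))
      ≡⟨ ∑-weight-extend φ (rel R) ⟩
    weight (step φ) (rel R)
      ∎)
    where open ≡-Reasoning

module PartitionCounts where

  open FiniteSums
  open BooleanRelations
  open WeightedCounts
  open import Data.Nat.Base
  open import Data.Nat.Properties using (*-zeroʳ; *-distribˡ-+; +-comm; ≡ᵇ⇒≡; *-commutativeSemigroup)
  open import Algebra.Properties.CommutativeSemigroup *-commutativeSemigroup using (x∙yz≈y∙xz)
  open import Data.Bool.Base using (Bool; true; false; _∧_)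
  open import Data.Bool.Properties using (∧-zeroʳ; ∧-conicalˡ; ∧-conicalʳ; T-≡)
  open import Function.Base using (_∘_)
  open import Function.Bundles using (Equivalence)
  open import Relation.Binary.PropositionalEquality using (_≡_; refl; sym; trans; cong; cong₂; module ≡-Reasoning)

  private variable
    n : ℕ

  count : ℕ → (ℕ → ℕ → ℕ) → ℕ
  count n φ = ∑[ R ∈ allRelations n ] weight φ (rel R)

  count-suc : ∀ n φ → count (suc n) φ ≡ count n (step φ)
  count-suc n = ∑-weight-suc {n}

  count-cong : ∀ n {φ ψ} → (∀ s k → φ s k ≡ ψ s k) → count n φ ≡ count n ψ
  count-cong n φ≗ψ = ∑-cong (allRelations n) λ R → cong (ind (isEquivalence (rel R)) *_) (φ≗ψ _ _)

  count-distrib-+ : ∀ n φ ψ → count n (λ s k → φ s k + ψ s k) ≡ count n φ + count n ψ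
  count-distrib-+ n φ ψ = trans (∑-cong (allRelations n) λ R → *-distribˡ-+ (ind (isEquivalence (rel R))) _ _)
                                  (∑-distrib-+ (allRelations n) (weight φ ∘ rel) (weight ψ ∘ rel))

  count-*ˡ : ∀ n c φ → count n (λ s k → c * φ s k) ≡ c * count n φ
  count-*ˡ n c φ = trans (∑-cong (allRelations n) λ R → x∙yz≈y∙xz (ind (isEquivalence (rel R))) c _)
                           (*-distribˡ-∑ c (allRelations n) (weight φ ∘ rel))

  count-shift : ∀ n (ψ : ℕ → ℕ → ℕ → ℕ) x → count n (λ s k → shift (λ t → ψ t s k) x) ≡ shift (λ t → count n (ψ t)) x
  count-shift n ψ zero    = ∑-zero (allRelations n) λ R → *-zeroʳ (ind (isEquivalence (rel R)))
  count-shift n ψ (suc x) = refl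

  atPoint : ℕ → ℕ → ℕ → ℕ → ℕ
  atPoint s k s′ k′ = ind ((s′ ≡ᵇ s) ∧ (k′ ≡ᵇ k))

  partitions : ℕ → ℕ → ℕ → ℕ
  partitions n s k = count n (atPoint s k)

  blocks≡singletons+bigBlocks : ∀ (r : BoolRel n) → countF (isLeast r) ≡ singletons r + bigBlocks r
  blocks≡singletons+bigBlocks r = trans (countF-split (isLeast r) (big ∘ size r)) (+-comm (bigBlocks r) _)

  private
    ≡ᵇ-cancelˡ : ∀ k a s → (k + a ≡ᵇ k + s) ≡ (a ≡ᵇ s)
    ≡ᵇ-cancelˡ zero    a s = refl
    ≡ᵇ-cancelˡ (suc k) a s = ≡ᵇ-cancelˡ k a s

    ≡ᵇ-cancelʳ : ∀ k a s → (a + k ≡ᵇ s + k) ≡ (a ≡ᵇ s)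
    ≡ᵇ-cancelʳ k a s = trans (cong₂ _≡ᵇ_ (+-comm a k) (+-comm s k)) (≡ᵇ-cancelˡ k a s)

    ≡ᵇ-true : ∀ a b → (a ≡ᵇ b) ≡ true → a ≡ b
    ≡ᵇ-true a b a≡ᵇb = ≡ᵇ⇒≡ a b (Equivalence.from T-≡ a≡ᵇb)

    ≡ᵇ-cancel-∧ : ∀ a b s k → (a + b ≡ᵇ s + k) ∧ (b ≡ᵇ k) ≡ (a ≡ᵇ s) ∧ (b ≡ᵇ k)
    ≡ᵇ-cancel-∧ a b s k with b ≡ᵇ k in b≡ᵇk
    ... | false = trans (∧-zeroʳ _) (sym (∧-zeroʳ _))
    ... | true with ≡ᵇ-true b k b≡ᵇk
    ...   | refl = cong (_∧ true) (≡ᵇ-cancelʳ b a s)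

  D≡partitions : ∀ n s k → D n (s + k) k ≡ partitions n s k
  D≡partitions n s k = trans (countL≡∑ _ (allRelations n)) (∑-cong (allRelations n) λ R →
    let r = rel R in begin
    ind (isEquivalence r ∧ (countF (isLeast r) ≡ᵇ s + k) ∧ (bigBlocks r ≡ᵇ k))
      ≡⟨ ind-∧ (isEquivalence r) _ ⟩
    ind (isEquivalence r) * ind ((countF (isLeast r) ≡ᵇ s + k) ∧ (bigBlocks r ≡ᵇ k))
      ≡⟨ cong (λ c → ind (isEquivalence r) * ind ((c ≡ᵇ s + k) ∧ (bigBlocks r ≡ᵇ k))) (blocks≡singletons+bigBlocks r) ⟩
    ind (isEquivalence r) * ind ((singletons r + bigBlocks r ≡ᵇ s + k) ∧ (bigBlocks r ≡ᵇ k))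
      ≡⟨ cong (λ b → ind (isEquivalence r) * ind b) (≡ᵇ-cancel-∧ (singletons r) (bigBlocks r) s k) ⟩
    weight (atPoint s k) r
      ∎)
    where open ≡-Reasoning

  private
    *-ind-cong : ∀ {x y} c → (c ≡ true → x ≡ y) → x * ind c ≡ y * ind c
    *-ind-cong true  x≡y = cong (_* 1) (x≡y refl)
    *-ind-cong {x} {y} false x≡y = trans (*-zeroʳ x) (sym (*-zeroʳ y))

  step-atPoint : ∀ s k s′ k′ → step (atPoint s k) s′ k′
    ≡ shift (λ t → atPoint t k s′ k′) s + k * atPoint s k s′ k′ + shift (λ t → suc s * atPoint (suc s) t s′ k′) k
  step-atPoint s k s′ k′ = cong₂ _+_ (cong₂ _+_ (new-singleton s) (*-ind-cong _ λ h → ≡ᵇ-true k′ k (∧-conicalʳ (s′ ≡ᵇ s) _ h)))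
                                     (joins-singleton s′ k)
    where
    new-singleton : ∀ s → atPoint s k (suc s′) k′ ≡ shift (λ t → atPoint t k s′ k′) s
    new-singleton zero    = refl
    new-singleton (suc s) = refl
    joins-singleton : ∀ s′ k → s′ * atPoint s k (pred s′) (suc k′) ≡ shift (λ t → suc s * atPoint (suc s) t s′ k′) k
    joins-singleton s′       zero    = trans (cong (λ b → s′ * ind b) (∧-zeroʳ _)) (*-zeroʳ s′)
    joins-singleton zero     (suc k) = sym (*-zeroʳ (suc s))
    joins-singleton (suc s′) (suc k) = *-ind-cong _ λ h → cong suc (≡ᵇ-true s′ s (∧-conicalˡ _ (k′ ≡ᵇ k) h))

  partitions-suc : ∀ n s k → partitions (suc n) s k
    ≡ shift (λ t → partitions n t k) s + k * partitions n s k + shift (λ t → suc s * partitions n (suc s) t) k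
  partitions-suc n s k = begin
    count (suc n) (atPoint s k)
      ≡⟨ count-suc n (atPoint s k) ⟩
    count n (step (atPoint s k))
      ≡⟨ count-cong n (step-atPoint s k) ⟩
    count n (λ s′ k′ → new s′ k′ + joinBig s′ k′ + joinSingleton s′ k′)
      ≡⟨ count-distrib-+ n (λ s′ k′ → new s′ k′ + joinBig s′ k′) joinSingleton ⟩
    count n (λ s′ k′ → new s′ k′ + joinBig s′ k′) + count n joinSingleton
      ≡⟨ cong (_+ count n joinSingleton) (count-distrib-+ n new joinBig) ⟩
    count n new + count n joinBig + count n joinSingleton
      ≡⟨ cong₂ _+_ (cong₂ _+_ (count-shift n (λ t → atPoint t k) s) (count-*ˡ n k (atPoint s k)))
                   (trans (count-shift n (λ t s′ k′ → suc s * atPoint (suc s) t s′ k′) k)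
                          (shift-cong (λ t → count-*ˡ n (suc s) (atPoint (suc s) t)) k)) ⟩
    shift (λ t → partitions n t k) s + k * partitions n s k + shift (λ t → suc s * partitions n (suc s) t) k
      ∎
    where
    open ≡-Reasoning
    new joinBig joinSingleton : ℕ → ℕ → ℕ
    new s′ k′           = shift (λ t → atPoint t k s′ k′) s
    joinBig s′ k′       = k * atPoint s k s′ k′
    joinSingleton s′ k′ = shift (λ t → suc s * atPoint (suc s) t s′ k′) k

module ClosedForm where

  open FiniteSums using (shift; shift-cong)
  open PartitionCounts
  open import Data.Nat.Base
  open import Data.Nat.Properties
  open import Algebra.Properties.CommutativeSemigroup *-commutativeSemigroup using (x∙yz≈y∙xz)
  open import Data.Nat.Combinatorics using (_C_; nC1≡n; k>n⇒nCk≡0; nCk+nC[k+1]≡[n+1]C[k+1])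
  open import Relation.Nullary.Decidable using (Dec; yes; no)
  open import Relation.Binary.PropositionalEquality using (_≡_; refl; sym; trans; cong; cong₂; module ≡-Reasoning)
  open ≡-Reasoning

  [k+1]*[n+1]C[k+1]≡[n+1]*nCk : ∀ n k → suc k * (suc n C suc k) ≡ suc n * (n C k)
  [k+1]*[n+1]C[k+1]≡[n+1]*nCk zero    zero    = refl
  [k+1]*[n+1]C[k+1]≡[n+1]*nCk zero    (suc k) = *-zeroʳ (suc (suc k))
  [k+1]*[n+1]C[k+1]≡[n+1]*nCk (suc n) zero    = trans (+-identityʳ _) (trans (nC1≡n (suc (suc n))) (sym (*-identityʳ _)))
  [k+1]*[n+1]C[k+1]≡[n+1]*nCk (suc n) (suc k) = begin
    suc (suc k) * (suc N C suc (suc k))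
      ≡⟨ cong (suc (suc k) *_) (nCk+nC[k+1]≡[n+1]C[k+1] N (suc k)) ⟨
    suc (suc k) * (N C suc k + N C suc (suc k))
      ≡⟨ *-distribˡ-+ (suc (suc k)) (N C suc k) _ ⟩
    N C suc k + suc k * (N C suc k) + suc (suc k) * (N C suc (suc k))
      ≡⟨ cong₂ (λ x y → N C suc k + x + y) ([k+1]*[n+1]C[k+1]≡[n+1]*nCk n k) ([k+1]*[n+1]C[k+1]≡[n+1]*nCk n (suc k)) ⟩
    N C suc k + N * (n C k) + N * (n C suc k)
      ≡⟨ +-assoc (N C suc k) _ _ ⟩
    N C suc k + (N * (n C k) + N * (n C suc k))
      ≡⟨ cong (N C suc k +_) (*-distribˡ-+ N (n C k) _) ⟨
    N C suc k + N * (n C k + n C suc k)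
      ≡⟨ cong (λ x → N C suc k + N * x) (nCk+nC[k+1]≡[n+1]C[k+1] n k) ⟩
    suc N * (N C suc k)
      ∎
    where N = suc n

  [n∸k]*nCk≡[k+1]*nC[k+1] : ∀ n k → (n ∸ k) * (n C k) ≡ suc k * (n C suc k)
  [n∸k]*nCk≡[k+1]*nC[k+1] zero    zero    = refl
  [n∸k]*nCk≡[k+1]*nC[k+1] zero    (suc k) = sym (*-zeroʳ (suc (suc k)))
  [n∸k]*nCk≡[k+1]*nC[k+1] (suc n) zero    = trans (*-identityʳ (suc n)) (sym (trans (+-identityʳ _) (nC1≡n (suc n))))
  [n∸k]*nCk≡[k+1]*nC[k+1] (suc n) (suc k) = begin
    (n ∸ k) * (suc n C suc k)
      ≡⟨ cong ((n ∸ k) *_) (nCk+nC[k+1]≡[n+1]C[k+1] n k) ⟨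
    (n ∸ k) * (n C k + n C suc k)
      ≡⟨ *-distribˡ-+ (n ∸ k) (n C k) _ ⟩
    (n ∸ k) * (n C k) + (n ∸ k) * (n C suc k)
      ≡⟨ cong (_+ (n ∸ k) * (n C suc k)) ([n∸k]*nCk≡[k+1]*nC[k+1] n k) ⟩
    suc k * (n C suc k) + (n ∸ k) * (n C suc k)
      ≡⟨ *-distribʳ-+ (n C suc k) (suc k) (n ∸ k) ⟨
    (suc k + (n ∸ k)) * (n C suc k)
      ≡⟨ suc-k+[n∸k] (k ≤? n) ⟩
    suc n * (n C suc k)
      ≡⟨ [k+1]*[n+1]C[k+1]≡[n+1]*nCk n (suc k) ⟨
    suc (suc k) * (suc n C suc (suc k))
      ∎
    where
    suc-k+[n∸k] : Dec (k ≤ n) → (suc k + (n ∸ k)) * (n C suc k) ≡ suc n * (n C suc k)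
    suc-k+[n∸k] (yes k≤n) = cong (λ m → suc m * (n C suc k)) (m+[n∸m]≡n k≤n)
    suc-k+[n∸k] (no  k≰n) rewrite k>n⇒nCk≡0 (m<n⇒m<1+n (≰⇒> k≰n)) = trans (*-zeroʳ (suc k + (n ∸ k))) (sym (*-zeroʳ (suc n)))

  [n+1∸k]*[n+1]Ck≡[n+1]*nCk : ∀ n k → (suc n ∸ k) * (suc n C k) ≡ suc n * (n C k)
  [n+1∸k]*[n+1]Ck≡[n+1]*nCk n k = trans ([n∸k]*nCk≡[k+1]*nC[k+1] (suc n) k) ([k+1]*[n+1]C[k+1]≡[n+1]*nCk n k)

  pascal-shift : ∀ n s → suc n C s ≡ shift (n C_) s + n C s
  pascal-shift n zero    = refl
  pascal-shift n (suc s) = sym (nCk+nC[k+1]≡[n+1]C[k+1] n s)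

  -- Associated Stirling numbers: partitions of an m-set into k blocks of size at least 2.
  S≥2 : ℕ → ℕ → ℕ
  S≥2 zero          zero    = 1
  S≥2 zero          (suc k) = 0
  S≥2 (suc m)       zero    = 0
  S≥2 (suc zero)    (suc k) = 0
  S≥2 (suc (suc m)) (suc k) = suc k * S≥2 (suc m) (suc k) + suc m * S≥2 m k

  S≥2-suc : ∀ m k → S≥2 (suc m) k ≡ k * S≥2 m k + shift (λ t → m * S≥2 (pred m) t) k
  S≥2-suc m       zero    = refl
  S≥2-suc zero    (suc k) = sym (trans (+-identityʳ _) (*-zeroʳ (suc k)))
  S≥2-suc (suc m) (suc k) = refl

  closed-form-step : ∀ n s k →
    (n C s) * S≥2 (suc n ∸ s) k
    ≡ k * ((n C s) * S≥2 (n ∸ s) k) + shift (λ t → suc s * ((n C suc s) * S≥2 (n ∸ suc s) t)) k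
  closed-form-step n s k with s ≤? n
  ... | no s≰n rewrite k>n⇒nCk≡0 (≰⇒> s≰n) | k>n⇒nCk≡0 (m<n⇒m<1+n (≰⇒> s≰n)) =
    sym (cong₂ _+_ (*-zeroʳ k) (trans (shift-cong (λ _ → *-zeroʳ (suc s)) k) (shift-zero k)))
    where
    shift-zero : ∀ x → shift (λ _ → 0) x ≡ 0
    shift-zero zero    = refl
    shift-zero (suc x) = refl
  ... | yes s≤n = begin
    (n C s) * S≥2 (suc n ∸ s) k
      ≡⟨ cong (λ m → (n C s) * S≥2 m k) (+-∸-assoc 1 s≤n) ⟩
    (n C s) * S≥2 (suc m) k
      ≡⟨ cong ((n C s) *_) (S≥2-suc m k) ⟩
    (n C s) * (k * S≥2 m k + shift (λ t → m * S≥2 (pred m) t) k)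
      ≡⟨ *-distribˡ-+ (n C s) _ _ ⟩
    (n C s) * (k * S≥2 m k) + (n C s) * shift (λ t → m * S≥2 (pred m) t) k
      ≡⟨ cong₂ _+_ (x∙yz≈y∙xz (n C s) k _) (join-singleton k) ⟩
    k * ((n C s) * S≥2 m k) + shift (λ t → suc s * ((n C suc s) * S≥2 (n ∸ suc s) t)) k
      ∎
    where
    m : ℕ
    m = n ∸ s
    join-singleton : ∀ x → (n C s) * shift (λ t → m * S≥2 (pred m) t) x
                         ≡ shift (λ t → suc s * ((n C suc s) * S≥2 (n ∸ suc s) t)) x
    join-singleton zero    = *-zeroʳ (n C s)
    join-singleton (suc t) = begin
      (n C s) * (m * S≥2 (pred m) t)        ≡⟨ x∙yz≈y∙xz (n C s) m _ ⟩
      m * ((n C s) * S≥2 (pred m) t)        ≡⟨ *-assoc m (n C s) _ ⟨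
      m * (n C s) * S≥2 (pred m) t          ≡⟨ cong₂ (λ c m′ → c * S≥2 m′ t) ([n∸k]*nCk≡[k+1]*nC[k+1] n s) (pred[m∸n]≡m∸[1+n] n s) ⟩
      suc s * (n C suc s) * S≥2 (n ∸ suc s) t ≡⟨ *-assoc (suc s) (n C suc s) _ ⟩
      suc s * ((n C suc s) * S≥2 (n ∸ suc s) t) ∎

  partitions-closed-form : ∀ n s k → partitions n s k ≡ (n C s) * S≥2 (n ∸ s) k
  partitions-closed-form zero    zero    zero    = refl
  partitions-closed-form zero    zero    (suc k) = refl
  partitions-closed-form zero    (suc s) k       = refl
  partitions-closed-form (suc n) s k = begin
    partitions (suc n) s k
      ≡⟨ partitions-suc n s k ⟩
    shift (λ t → partitions n t k) s + k * partitions n s k + shift (λ t → suc s * partitions n (suc s) t) k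
      ≡⟨ cong₂ _+_ (cong₂ _+_ (shift-cong (λ t → partitions-closed-form n t k) s) (cong (k *_) (partitions-closed-form n s k)))
                   (shift-cong (λ t → cong (suc s *_) (partitions-closed-form n (suc s) t)) k) ⟩
    shift (λ t → (n C t) * S≥2 (n ∸ t) k) s + k * ((n C s) * S≥2 (n ∸ s) k)
      + shift (λ t → suc s * ((n C suc s) * S≥2 (n ∸ suc s) t)) k
      ≡⟨ +-assoc (shift (λ t → (n C t) * S≥2 (n ∸ t) k) s) _ _ ⟩
    shift (λ t → (n C t) * S≥2 (n ∸ t) k) s
      + (k * ((n C s) * S≥2 (n ∸ s) k) + shift (λ t → suc s * ((n C suc s) * S≥2 (n ∸ suc s) t)) k)
      ≡⟨ cong₂ _+_ (new-singleton s) (closed-form-step n s k) ⟨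
    shift (n C_) s * S≥2 (suc n ∸ s) k + (n C s) * S≥2 (suc n ∸ s) k
      ≡⟨ *-distribʳ-+ (S≥2 (suc n ∸ s) k) (shift (n C_) s) _ ⟨
    (shift (n C_) s + n C s) * S≥2 (suc n ∸ s) k
      ≡⟨ cong (_* S≥2 (suc n ∸ s) k) (pascal-shift n s) ⟨
    (suc n C s) * S≥2 (suc n ∸ s) k
      ∎
    where
    new-singleton : ∀ s → shift (n C_) s * S≥2 (suc n ∸ s) k ≡ shift (λ t → (n C t) * S≥2 (n ∸ t) k) s
    new-singleton zero    = refl
    new-singleton (suc s) = refl

  D-closed-form : ∀ n s k → D n (s + k) k ≡ (n C s) * S≥2 (n ∸ s) k
  D-closed-form n s k = trans (D≡partitions n s k) (partitions-closed-form n s k)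

module AlternatingSums where

  open ClosedForm using (S≥2; [n+1∸k]*[n+1]Ck≡[n+1]*nCk)
  open import Data.Nat.Base as ℕ using (ℕ; zero; suc; _∸_; _≤_; z≤n)
  import Data.Nat.Properties as ℕₚ
  open import Data.Nat.Combinatorics using (_C_; k>n⇒nCk≡0; nCk+nC[k+1]≡[n+1]C[k+1])
  open import Data.Integer.Base using (ℤ; +_; -[1+_]; -1ℤ; _+_; _-_; _*_; -_; _^_)
  open import Data.Integer.Properties using (pos-+; pos-*; *-zeroʳ; +-identityˡ; +-identityʳ; +-assoc; *-distribˡ-+; *-distribʳ-+; +-commutativeSemigroup)
  open import Algebra.Properties.CommutativeSemigroup +-commutativeSemigroup using (interchange)
  open import Data.Integer.Tactic.RingSolver using (solve-∀)
  open import Function.Base using (_∘_)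
  open import Relation.Binary.PropositionalEquality using (_≡_; refl; sym; trans; cong; cong₂; module ≡-Reasoning)
  open import Relation.Nullary.Decidable using (yes; no)
  open ≡-Reasoning

  sumTo-cong : ∀ m {f g : ℕ → ℤ} → (∀ i → i ≤ m → f i ≡ g i) → sumTo m f ≡ sumTo m g
  sumTo-cong zero    f≗g = f≗g 0 z≤n
  sumTo-cong (suc m) f≗g = cong₂ _+_ (sumTo-cong m λ i i≤m → f≗g i (ℕₚ.m≤n⇒m≤1+n i≤m)) (f≗g (suc m) ℕₚ.≤-refl)

  sumTo-zero : ∀ m (f : ℕ → ℤ) → (∀ i → i ≤ m → f i ≡ + 0) → sumTo m f ≡ + 0
  sumTo-zero zero    f f≗0 = f≗0 0 z≤n
  sumTo-zero (suc m) f f≗0 = cong₂ _+_ (sumTo-zero m f λ i i≤m → f≗0 i (ℕₚ.m≤n⇒m≤1+n i≤m)) (f≗0 (suc m) ℕₚ.≤-refl)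

  sumTo-distrib-+ : ∀ m (f g : ℕ → ℤ) → sumTo m (λ i → f i + g i) ≡ sumTo m f + sumTo m g
  sumTo-distrib-+ zero    f g = refl
  sumTo-distrib-+ (suc m) f g = trans (cong (_+ (f (suc m) + g (suc m))) (sumTo-distrib-+ m f g))
                                      (interchange (sumTo m f) (sumTo m g) (f (suc m)) (g (suc m)))

  *-distribˡ-sumTo : ∀ c m (f : ℕ → ℤ) → sumTo m (λ i → c * f i) ≡ c * sumTo m f
  *-distribˡ-sumTo c zero    f = refl
  *-distribˡ-sumTo c (suc m) f = trans (cong (_+ c * f (suc m)) (*-distribˡ-sumTo c m f)) (sym (*-distribˡ-+ c (sumTo m f) _))

  sumTo-suc : ∀ m (f : ℕ → ℤ) → sumTo (suc m) f ≡ f 0 + sumTo m (f ∘ suc)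
  sumTo-suc zero    f = refl
  sumTo-suc (suc m) f = trans (cong (_+ f (suc (suc m))) (sumTo-suc m f)) (+-assoc (f 0) _ _)

  sumTo-pascal : ∀ m (f : ℕ → ℤ) →
    sumTo (suc m) (λ i → + (suc m C i) * f i) ≡ sumTo m (λ i → + (m C i) * (f i + f (suc i)))
  sumTo-pascal m f = begin
    sumTo (suc m) (λ i → + (suc m C i) * f i)
      ≡⟨ sumTo-suc m _ ⟩
    + 1 * f 0 + sumTo m (λ i → + (suc m C suc i) * f (suc i))
      ≡⟨ cong (λ x → + 1 * f 0 + x) (trans (sumTo-cong m λ i _ → pascal i) (sumTo-distrib-+ m A B)) ⟩
    + 1 * f 0 + (sumTo m A + sumTo m B)
      ≡⟨ rearrange (+ 1 * f 0) (sumTo m A) (sumTo m B) ⟩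
    (+ 1 * f 0 + sumTo m B) + sumTo m A
      ≡⟨ cong (_+ sumTo m A) lower ⟨
    sumTo m (λ i → + (m C i) * f i) + sumTo m A
      ≡⟨ trans (sumTo-cong m λ i _ → *-distribˡ-+ (+ (m C i)) (f i) _) (sumTo-distrib-+ m _ A) ⟨
    sumTo m (λ i → + (m C i) * (f i + f (suc i)))
      ∎
    where
    A B : ℕ → ℤ
    A i = + (m C i) * f (suc i)
    B i = + (m C suc i) * f (suc i)
    pascal : ∀ i → + (suc m C suc i) * f (suc i) ≡ A i + B i
    pascal i = trans (cong (λ c → + c * f (suc i)) (sym (nCk+nC[k+1]≡[n+1]C[k+1] m i)))
                     (trans (cong (_* f (suc i)) (pos-+ (m C i) _)) (*-distribʳ-+ (f (suc i)) (+ (m C i)) (+ (m C suc i))))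
    lower : sumTo m (λ i → + (m C i) * f i) ≡ + 1 * f 0 + sumTo m B
    lower = begin
      sumTo m (λ i → + (m C i) * f i)
        ≡⟨ +-identityʳ _ ⟨
      sumTo m (λ i → + (m C i) * f i) + + 0
        ≡⟨ cong (λ c → sumTo m (λ i → + (m C i) * f i) + + c * f (suc m)) (k>n⇒nCk≡0 (ℕₚ.n<1+n m)) ⟨
      sumTo (suc m) (λ i → + (m C i) * f i)
        ≡⟨ sumTo-suc m _ ⟩
      + 1 * f 0 + sumTo m B
        ∎
    rearrange : ∀ a x y → a + (x + y) ≡ (a + y) + x
    rearrange = solve-∀

  S-suc : ∀ u b → + S (suc u) b ≡ b * + S u b + + S u (b - + 1)
  S-suc u (+ zero)  = refl
  S-suc u (+ suc b) = trans (pos-+ (suc b ℕ.* Sₙ u (suc b)) (Sₙ u b)) (cong (_+ + Sₙ u b) (pos-* (suc b) (Sₙ u (suc b))))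
  S-suc u -[1+ b ]  = sym (cong (_+ + 0) (*-zeroʳ -[1+ b ]))

  term : ℕ → ℤ → ℕ → ℤ
  term m b i = -1ℤ ^ (m ∸ i) * + (m C i) * + S i (b + + i - + m)

  alternatingSum : ℕ → ℤ → ℤ
  alternatingSum m b = sumTo m (term m b)

  alternatingSum-suc : ∀ m b → alternatingSum (suc m) b ≡ sumTo m (λ i → (b - + (m ∸ i)) * term m b i)
  alternatingSum-suc m b = begin
    sumTo (suc m) (term (suc m) b)
      ≡⟨ sumTo-cong (suc m) (λ i _ → binomial-first (-1ℤ ^ (suc m ∸ i)) (+ (suc m C i)) _) ⟩
    sumTo (suc m) (λ i → + (suc m C i) * f i)
      ≡⟨ sumTo-pascal m f ⟩
    sumTo m (λ i → + (m C i) * (f i + f (suc i)))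
      ≡⟨ sumTo-cong m (λ i i≤m → trans (cong (+ (m C i) *_) (adjacent i≤m))
                                        (weight-first (+ (m C i)) (-1ℤ ^ (m ∸ i)) (b - + (m ∸ i)) (+ S i (b + + i - + m)))) ⟩
    sumTo m (λ i → (b - + (m ∸ i)) * term m b i)
      ∎
    where
    f : ℕ → ℤ
    f i = -1ℤ ^ (suc m ∸ i) * + S i (b + + i - + suc m)
    binomial-first : ∀ σ c x → σ * c * x ≡ c * (σ * x)
    binomial-first = solve-∀
    weight-first : ∀ c σ w x → c * (σ * (w * x)) ≡ w * (σ * c * x)
    weight-first = solve-∀
    adjacent : ∀ {i} → i ≤ m → f i + f (suc i) ≡ -1ℤ ^ (m ∸ i) * ((b - + (m ∸ i)) * + S i (b + + i - + m))
    adjacent {i} i≤m = begin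
      f i + f (suc i)
        ≡⟨ cong₂ _+_ (cong₂ (λ e a → -1ℤ ^ e * + S i a) (ℕₚ.+-∸-assoc 1 i≤m) (below b (+ i) (+ m)))
                     (cong (λ a → σ * + S (suc i) a) (shift-both b (+ i) (+ m))) ⟩
      -1ℤ * σ * + S i (c - + 1) + σ * + S (suc i) c
        ≡⟨ cong (λ x → -1ℤ * σ * + S i (c - + 1) + σ * x) (S-suc i c) ⟩
      -1ℤ * σ * + S i (c - + 1) + σ * (c * + S i c + + S i (c - + 1))
        ≡⟨ cancel σ c (+ S i c) (+ S i (c - + 1)) ⟩
      σ * (c * + S i c)
        ≡⟨ cong (λ x → σ * (x * + S i c)) (trans (cong (λ y → b + + i - y) +m≡) (drop-i b (+ i) (+ (m ∸ i)))) ⟩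
      σ * ((b - + (m ∸ i)) * + S i c)
        ∎
      where
      σ c : ℤ
      σ = -1ℤ ^ (m ∸ i)
      c = b + + i - + m
      +m≡ : + m ≡ + i + + (m ∸ i)
      +m≡ = trans (cong +_ (sym (ℕₚ.m+[n∸m]≡n i≤m))) (pos-+ i (m ∸ i))
      below : ∀ b i m → b + i - (+ 1 + m) ≡ b + i - m - + 1
      below = solve-∀
      shift-both : ∀ b i m → b + (+ 1 + i) - (+ 1 + m) ≡ b + i - m
      shift-both = solve-∀
      cancel : ∀ σ c x y → -1ℤ * σ * y + σ * (c * x + y) ≡ σ * (c * x)
      cancel = solve-∀
      drop-i : ∀ b i d → b + i - (i + d) ≡ b - d
      drop-i = solve-∀

  private
    sign-absorb : ∀ m i → + (suc m ∸ i) * -1ℤ ^ (suc m ∸ i) ≡ - (+ (suc m ∸ i) * -1ℤ ^ (m ∸ i))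
    sign-absorb m i with i ℕₚ.≤? m
    ... | yes i≤m rewrite ℕₚ.+-∸-assoc 1 i≤m = flip (+ suc (m ∸ i)) (-1ℤ ^ (m ∸ i))
      where
      flip : ∀ x σ → x * (-1ℤ * σ) ≡ - (x * σ)
      flip = solve-∀
    ... | no  i≰m rewrite ℕₚ.m≤n⇒m∸n≡0 (ℕₚ.≰⇒> i≰m) = refl

    binomial-absorb : ∀ m i → + (suc m ∸ i) * + (suc m C i) ≡ + suc m * + (m C i)
    binomial-absorb m i = trans (sym (pos-* (suc m ∸ i) _)) (trans (cong +_ ([n+1∸k]*[n+1]Ck≡[n+1]*nCk m i)) (pos-* (suc m) _))

  alternatingSum-suc-suc : ∀ m b → alternatingSum (suc (suc m)) b ≡ b * alternatingSum (suc m) b + + suc m * alternatingSum m (b - + 1)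
  alternatingSum-suc-suc m b = begin
    alternatingSum (suc (suc m)) b
      ≡⟨ alternatingSum-suc (suc m) b ⟩
    sumTo (suc m) (λ i → (b - + (suc m ∸ i)) * term (suc m) b i)
      ≡⟨ sumTo-cong (suc m) (λ i _ → split i) ⟩
    sumTo (suc m) (λ i → b * term (suc m) b i + + suc m * term m (b - + 1) i)
      ≡⟨ sumTo-distrib-+ (suc m) _ _ ⟩
    sumTo (suc m) (λ i → b * term (suc m) b i) + sumTo (suc m) (λ i → + suc m * term m (b - + 1) i)
      ≡⟨ cong₂ _+_ (*-distribˡ-sumTo b (suc m) _) (*-distribˡ-sumTo (+ suc m) (suc m) _) ⟩
    b * alternatingSum (suc m) b + + suc m * sumTo (suc m) (term m (b - + 1))
      ≡⟨ cong (λ x → b * alternatingSum (suc m) b + + suc m * x)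
              (trans (cong (λ y → alternatingSum m (b - + 1) + y) top-vanishes) (+-identityʳ _)) ⟩
    b * alternatingSum (suc m) b + + suc m * alternatingSum m (b - + 1)
      ∎
    where
    top-vanishes : term m (b - + 1) (suc m) ≡ + 0
    top-vanishes = trans (cong (λ c → σ * + c * x) (k>n⇒nCk≡0 (ℕₚ.n<1+n m))) (cong (_* x) (*-zeroʳ σ))
      where
      σ x : ℤ
      σ = -1ℤ ^ (m ∸ suc m)
      x = + S (suc m) (b - + 1 + + suc m - + m)
    split : ∀ i → (b - + (suc m ∸ i)) * term (suc m) b i ≡ b * term (suc m) b i + + suc m * term m (b - + 1) i
    split i = begin
      (b - d) * term (suc m) b i
        ≡⟨ distrib b d (term (suc m) b i) ⟩
      b * term (suc m) b i - d * (-1ℤ ^ (suc m ∸ i) * + (suc m C i) * x)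
        ≡⟨ cong (λ y → b * term (suc m) b i - y) (regroup d (-1ℤ ^ (suc m ∸ i)) (+ (suc m C i)) x) ⟩
      b * term (suc m) b i - (d * -1ℤ ^ (suc m ∸ i)) * + (suc m C i) * x
        ≡⟨ cong (λ y → b * term (suc m) b i - y * + (suc m C i) * x) (sign-absorb m i) ⟩
      b * term (suc m) b i - - (d * -1ℤ ^ (m ∸ i)) * + (suc m C i) * x
        ≡⟨ regroup′ (b * term (suc m) b i) d (-1ℤ ^ (m ∸ i)) (+ (suc m C i)) x ⟩
      b * term (suc m) b i + -1ℤ ^ (m ∸ i) * (d * + (suc m C i)) * x
        ≡⟨ cong₂ (λ y a → b * term (suc m) b i + -1ℤ ^ (m ∸ i) * y * + S i a) (binomial-absorb m i) (lower b (+ i) (+ m)) ⟩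
      b * term (suc m) b i + -1ℤ ^ (m ∸ i) * (+ suc m * + (m C i)) * + S i (b - + 1 + + i - + m)
        ≡⟨ cong (λ y → b * term (suc m) b i + y) (regroup″ (-1ℤ ^ (m ∸ i)) (+ suc m) (+ (m C i)) _) ⟩
      b * term (suc m) b i + + suc m * term m (b - + 1) i
        ∎
      where
      d x : ℤ
      d = + (suc m ∸ i)
      x = + S i (b + + i - + suc m)
      distrib : ∀ b d t → (b - d) * t ≡ b * t - d * t
      distrib = solve-∀
      regroup : ∀ d σ c x → d * (σ * c * x) ≡ (d * σ) * c * x
      regroup = solve-∀
      regroup′ : ∀ y d σ c x → y - - (d * σ) * c * x ≡ y + σ * (d * c) * x
      regroup′ = solve-∀
      lower : ∀ b i m → b + i - (+ 1 + m) ≡ b - + 1 + i - m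
      lower = solve-∀
      regroup″ : ∀ σ n c x → σ * (n * c) * x ≡ n * (σ * c * x)
      regroup″ = solve-∀

  alternatingSum-negative : ∀ m c → alternatingSum m -[1+ c ] ≡ + 0
  alternatingSum-negative m c = sumTo-zero m (term m -[1+ c ]) λ i i≤m →
    trans (cong (λ a → -1ℤ ^ (m ∸ i) * + (m C i) * + S i a) (negative-argument i≤m)) (*-zeroʳ (-1ℤ ^ (m ∸ i) * + (m C i)))
    where
    negative-argument : ∀ {i} → i ≤ m → -[1+ c ] + + i - + m ≡ -[1+ (c ℕ.+ (m ∸ i)) ]
    negative-argument {i} i≤m = trans (cong (λ y → -[1+ c ] + + i - y) +m≡) (drop-i (+ c) (+ i) (+ (m ∸ i)))
      where
      +m≡ : + m ≡ + i + + (m ∸ i)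
      +m≡ = trans (cong +_ (sym (ℕₚ.m+[n∸m]≡n i≤m))) (pos-+ i (m ∸ i))
      drop-i : ∀ c i d → - (+ 1 + c) + i - (i + d) ≡ - (+ 1 + (c + d))
      drop-i = solve-∀

  alternatingSum≡S≥2 : ∀ m k → alternatingSum m (+ k) ≡ + S≥2 m k
  alternatingSum≡S≥2 zero          zero    = refl
  alternatingSum≡S≥2 zero          (suc k) = refl
  alternatingSum≡S≥2 (suc zero)    zero    = refl
  alternatingSum≡S≥2 (suc zero)    (suc k) = trans (alternatingSum-suc 0 (+ suc k)) (*-zeroʳ (+ suc k - + 0))
  alternatingSum≡S≥2 (suc (suc m)) zero    = begin
    alternatingSum (suc (suc m)) (+ 0)                                        ≡⟨ alternatingSum-suc-suc m (+ 0) ⟩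
    + 0 * alternatingSum (suc m) (+ 0) + + suc m * alternatingSum m -[1+ 0 ]  ≡⟨ +-identityˡ _ ⟩
    + suc m * alternatingSum m -[1+ 0 ]                                       ≡⟨ cong (λ x → + suc m * x) (alternatingSum-negative m 0) ⟩
    + suc m * + 0                                                             ≡⟨ *-zeroʳ (+ suc m) ⟩
    + 0                                                                       ∎
  alternatingSum≡S≥2 (suc (suc m)) (suc k) = begin
    alternatingSum (suc (suc m)) (+ suc k)
      ≡⟨ alternatingSum-suc-suc m (+ suc k) ⟩
    + suc k * alternatingSum (suc m) (+ suc k) + + suc m * alternatingSum m (+ k)
      ≡⟨ cong₂ (λ x y → + suc k * x + + suc m * y) (alternatingSum≡S≥2 (suc m) (suc k)) (alternatingSum≡S≥2 m k) ⟩
    + suc k * + S≥2 (suc m) (suc k) + + suc m * + S≥2 m k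
      ≡⟨ cong₂ _+_ (pos-* (suc k) (S≥2 (suc m) (suc k))) (pos-* (suc m) (S≥2 m k)) ⟨
    + (suc k ℕ.* S≥2 (suc m) (suc k)) + + (suc m ℕ.* S≥2 m k)
      ≡⟨ pos-+ (suc k ℕ.* S≥2 (suc m) (suc k)) (suc m ℕ.* S≥2 m k) ⟨
    + S≥2 (suc (suc m)) (suc k)
      ∎

open import Data.Nat using (ℕ; _≤_; _∸_; _+_)
open import Data.Nat.Combinatorics using (_C_)
open import Data.Integer as ℤ using (ℤ; +_; -1ℤ; _^_; _*_; _-_)
open import Relation.Binary.PropositionalEquality using (_≡_)

import Data.Nat as ℕ
import Data.Nat.Properties as ℕₚ
open import Data.Integer.Properties using (pos-+; pos-*)
open import Data.Integer.Tactic.RingSolver using (solve-∀)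
open import Relation.Binary.PropositionalEquality using (sym; trans; cong; cong₂; module ≡-Reasoning)
open ClosedForm using (S≥2; D-closed-form)
open AlternatingSums using (alternatingSum; alternatingSum≡S≥2; sumTo-cong)

lemma3p1 : (n j k : ℕ) → k ≤ j → j ≤ n →
  + D n j k ≡
    + (n C (j ∸ k)) *
      sumTo (n ∸ (j ∸ k)) (λ i →
        (-1ℤ ^ (n ∸ (j ∸ k) ∸ i)) * + ((n ∸ (j ∸ k)) C i) * + S i ((+ (j + i)) - (+ n)))
lemma3p1 n j k k≤j j≤n = begin
  + D n j k                           ≡⟨ cong (λ j → + D n j k) j≡s+k ⟩
  + D n (s + k) k                     ≡⟨ cong +_ (D-closed-form n s k) ⟩
  + ((n C s) ℕ.* S≥2 m k)             ≡⟨ pos-* (n C s) (S≥2 m k) ⟩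
  + (n C s) * + S≥2 m k               ≡⟨ cong (+ (n C s) *_) (alternatingSum≡S≥2 m k) ⟨
  + (n C s) * alternatingSum m (+ k)  ≡⟨ cong (+ (n C s) *_) (sumTo-cong m λ i _ →
                                           cong (λ a → (-1ℤ ^ (m ∸ i)) * + (m C i) * + S i a) (argument i)) ⟩
  + (n C s) * sumTo m (λ i → (-1ℤ ^ (m ∸ i)) * + (m C i) * + S i ((+ (j + i)) - (+ n)))  ∎
  where
  open ≡-Reasoning
  s m : ℕ
  s = j ∸ k
  m = n ∸ s
  j≡s+k : j ≡ s + k
  j≡s+k = sym (ℕₚ.m∸n+n≡m k≤j)
  n≡m+s : n ≡ m + s
  n≡m+s = sym (ℕₚ.m∸n+n≡m (ℕₚ.≤-trans (ℕₚ.m∸n≤m j k) j≤n))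
  argument : ∀ i → + k ℤ.+ + i - + m ≡ + (j + i) - + n
  argument i = trans (add-s (+ s) (+ k) (+ i) (+ m)) (cong₂ _-_
    (trans (cong (ℤ._+ + i) (sym (pos-+ s k))) (trans (sym (pos-+ (s + k) i)) (cong (λ x → + (x + i)) (sym j≡s+k))))
    (trans (sym (pos-+ m s)) (cong +_ (sym n≡m+s))))
    where
    add-s : ∀ s k i m → k ℤ.+ i - m ≡ (s ℤ.+ k ℤ.+ i) - (m ℤ.+ s)
    add-s = solve-∀
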